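{- Let $\Gamma$ be a connected, isthmus-free (bridgeless), $3$-regular simple graph. Then there exists a signature $\sigma$ on $\Gamma$ such that the signed graph $(\Gamma,\sigma)$ has a proper $3$-edge coloring.
   Context: A signed graph is $\Sigma=(\Gamma,\sigma)$ with $\Gamma$ a finite simple graph and $\sigma:E(\Gamma)\to\{+,-\}$ (the signature). An incidence is a pair $(v,e)$ with $v$ an endpoint of $e$. Let $M_3=\{0,1,-1\}$. A $3$-edge coloring of $\Sigma$ is a map $\gamma$ from incidences to $M_3$ with $\gamma(v,e)=-\sigma(e)\gamma(w,e)$ for each edge $e$ with endpoints $v,w$; it is proper if $\gamma(v,e)\neq\gamma(v,f)$ for distinct edges $e,f$ sharing an endpoint $v$. -}

module Defs where

open import Data.Nat using (ℕ)
open import Data.Fin using (Fin)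
open import Data.Bool using (Bool; true; false; _∧_; not)
open import Data.List using (List; filterᵇ; length; allFin)
open import Data.Fin using (_≟_)
open import Relation.Nullary.Decidable using (⌊_⌋)
open import Relation.Binary.PropositionalEquality using (_≡_; _≢_)
open import Data.Product using (Σ; _×_; _,_)

record SimpleGraph (n : ℕ) : Set where
  field
    adj   : Fin n → Fin n → Bool
    sym   : ∀ v w → adj v w ≡ adj w v
    loopless : ∀ v → adj v v ≡ false
open SimpleGraph public

Adj : ∀ {n} → SimpleGraph n → Fin n → Fin n → Set
Adj G v w = adj G v w ≡ true

degree : ∀ {n} → SimpleGraph n → Fin n → ℕ
degree {n} G v = length (filterᵇ (adj G v) (allFin n))

Cubic : ∀ {n} → SimpleGraph n → Set
Cubic G = ∀ v → degree G v ≡ 3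

data Walk {n : ℕ} (a : Fin n → Fin n → Bool) : Fin n → Fin n → Set where
  nil  : ∀ {v} → Walk a v v
  cons : ∀ {u v w} → a u v ≡ true → Walk a v w → Walk a u w

Connected : ∀ {n} → SimpleGraph n → Set
Connected G = ∀ u v → Walk (adj G) u v

deleteEdge : ∀ {n} → SimpleGraph n → Fin n → Fin n → Fin n → Fin n → Bool
deleteEdge G x y u v =
  adj G u v ∧ not ((⌊ u ≟ x ⌋ ∧ ⌊ v ≟ y ⌋) Data.Bool.∨ (⌊ u ≟ y ⌋ ∧ ⌊ v ≟ x ⌋))

-- isthmus-free: no edge is a bridge, i.e. deleting any edge {x,y}
-- leaves x and y joined by a walk (equivalently, does not increase
-- the number of connected components)
Bridgeless : ∀ {n} → SimpleGraph n → Set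
Bridgeless G = ∀ x y → Adj G x y → Walk (deleteEdge G x y) x y

data Sign : Set where
  plus minus : Sign

data M3 : Set where
  zero one minusOne : M3

negM : M3 → M3
negM zero = zero
negM one = minusOne
negM minusOne = one

_·_ : Sign → M3 → M3
plus · x = x
minus · x = negM x

-- a signature: a sign for each edge; represented on ordered pairs,
-- required to be symmetric on edges (so it is a function of the edge)
Signature : ∀ {n} → SimpleGraph n → Set
Signature {n} G = Σ (Fin n → Fin n → Sign) λ σ → ∀ v w → Adj G v w → σ v w ≡ σ w v

-- an incidence (v, e) with e = {v,w} is encoded as the ordered pair (v,w)
-- with v adjacent to w; a 3-edge coloring assigns an element of M₃ to each
-- incidence (values on non-adjacent pairs are irrelevant)
IsColoring : ∀ {n} (G : SimpleGraph n) → (Fin n → Fin n → Sign) → (Fin n → Fin n → M3) → Set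
IsColoring G σ γ = ∀ v w → Adj G v w → γ v w ≡ negM (σ v w · γ w v)

IsProper : ∀ {n} (G : SimpleGraph n) → (Fin n → Fin n → M3) → Set
IsProper G γ = ∀ v w u → Adj G v w → Adj G v u → w ≢ u → γ v w ≢ γ v u

HasProper3EdgeColoring : ∀ {n} (G : SimpleGraph n) → Signature G → Set
HasProper3EdgeColoring {n} G (σ , _) =
  Σ (Fin n → Fin n → M3) λ γ → IsColoring G σ γ × IsProper G γ

-- Color the edges of a perfect matching 0 at both ends, give the other two edges at each vertex
-- the colors 1 and -1, and let σ(e) = - exactly when e has the same color at both ends: this is
-- a proper 3-edge coloring.  So it suffices to prove Petersen's theorem, that a bridgeless cubic
-- graph G has a perfect matching.
--
-- Following Lovász, every simple supergraph H of G has a perfect matching, by induction on the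
-- number of non-edges of H.  If some vertex y not adjacent to all others has neighbours x, z with
-- xz not an edge, pick w not adjacent to y and perfect matchings M₁ of H + xz and M₂ of H + yw.
-- Unless one of them already avoids its new edge, follow the walk from y alternating between M₂
-- and M₁: if it returns to y without meeting x or z, take M₁ on that cycle and M₂ elsewhere;
-- otherwise it first meets t ∈ {x, z} by an M₂-edge, and M₁ on the walk strictly between y and t,
-- the edge yt and M₂ elsewhere form a perfect matching of H.  If no such y exists, the non-universal vertices fall
-- into cliques of H.  The G-edges from an odd clique C to the universal vertices number
-- 3|C| - 2 e(C), which is odd, and not 1 as G has no bridge, so at least 3; each universal vertex
-- takes at most 3 of them.  Hence the odd cliques can be given distinct universal partners, and
-- pairing up within cliques and among the remaining universal vertices matches everything.

module Submission where

open import Defs hiding (sym)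
open import Data.Nat using (ℕ)
open import Data.Product using (Σ)

module Sums where

  open import Data.Nat using (ℕ; zero; suc; _+_; _*_; _≤_; _<_; z≤n; s≤s)
  open import Data.Nat.Properties
  open import Data.Fin using (Fin; zero; suc)
  import Data.Fin.Properties as Fin
  open import Data.Bool using (Bool; true; false; not; _∧_)
  open import Data.Product using (∃; _×_; _,_)
  open import Data.Empty using (⊥-elim)
  open import Relation.Binary.PropositionalEquality
  open import Function using (_∘_)
  open import Algebra.Properties.Semiring.Sum +-*-semiring public
    using (sum; sum-syntax; sum-cong-≗; ∑-distrib-+; ∑-comm; *-distribˡ-sum; *-distribʳ-sum)

  𝟙 : Bool → ℕ
  𝟙 true = 1
  𝟙 false = 0

  𝟙≤1 : ∀ b → 𝟙 b ≤ 1
  𝟙≤1 true = s≤s z≤n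
  𝟙≤1 false = z≤n

  𝟙-not-antitone : ∀ {b c} → (b ≡ true → c ≡ true) → 𝟙 (not c) ≤ 𝟙 (not b)
  𝟙-not-antitone {true} b⇒c rewrite b⇒c refl = z≤n
  𝟙-not-antitone {false} {c} _ = 𝟙≤1 (not c)

  𝟙-pos : ∀ {b} → 0 < 𝟙 b → b ≡ true
  𝟙-pos {true} _ = refl

  𝟙-∧ : ∀ a b → 𝟙 (a ∧ b) ≡ 𝟙 a * 𝟙 b
  𝟙-∧ true b = sym (+-identityʳ (𝟙 b))
  𝟙-∧ false b = refl

  𝟙*-pos : ∀ a m → 0 < 𝟙 a * m → a ≡ true × 0 < m
  𝟙*-pos true m 0<m = refl , subst (0 <_) (+-identityʳ m) 0<m

  𝟙*-true : ∀ {a} m → a ≡ true → 𝟙 a * m ≡ m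
  𝟙*-true m refl = +-identityʳ m

  sum-const : ∀ n c → ∑[ i < n ] c ≡ n * c
  sum-const zero c = refl
  sum-const (suc n) c = cong (c +_) (sum-const n c)

  sum-mono-≤ : ∀ {n} {f g : Fin n → ℕ} → (∀ i → f i ≤ g i) → sum f ≤ sum g
  sum-mono-≤ {zero} f≤g = z≤n
  sum-mono-≤ {suc n} f≤g = +-mono-≤ (f≤g zero) (sum-mono-≤ (f≤g ∘ suc))

  sum-mono-< : ∀ {n} {f g : Fin n → ℕ} → (∀ i → f i ≤ g i) → ∀ i → f i < g i → sum f < sum g
  sum-mono-< {suc n} f≤g zero f0<g0 = +-mono-<-≤ f0<g0 (sum-mono-≤ (f≤g ∘ suc))
  sum-mono-< {suc n} f≤g (suc i) fi<gi = +-mono-≤-< (f≤g zero) (sum-mono-< (f≤g ∘ suc) i fi<gi)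

  term≤sum : ∀ {n} (f : Fin n → ℕ) i → f i ≤ sum f
  term≤sum f zero = m≤m+n (f zero) _
  term≤sum f (suc i) = ≤-trans (term≤sum (f ∘ suc) i) (m≤n+m _ (f zero))

  twoTerms≤sum : ∀ {n} (f : Fin n → ℕ) {i j} → i ≢ j → f i + f j ≤ sum f
  twoTerms≤sum f {zero} {zero} i≢j = ⊥-elim (i≢j refl)
  twoTerms≤sum f {zero} {suc j} _ = +-monoʳ-≤ (f zero) (term≤sum (f ∘ suc) j)
  twoTerms≤sum f {suc i} {zero} _ =
    subst (_≤ sum f) (+-comm (f zero) (f (suc i))) (+-monoʳ-≤ (f zero) (term≤sum (f ∘ suc) i))
  twoTerms≤sum f {suc i} {suc j} i≢j =
    ≤-trans (twoTerms≤sum (f ∘ suc) (i≢j ∘ cong suc)) (m≤n+m _ (f zero))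

  sum-pos⇒term-pos : ∀ {n} (f : Fin n → ℕ) → 0 < sum f → ∃ λ i → 0 < f i
  sum-pos⇒term-pos {suc n} f 0<Σ with f zero in f0≡
  ... | suc _ = zero , subst (0 <_) (sym f0≡) (s≤s z≤n)
  ... | zero with i , 0<fi ← sum-pos⇒term-pos (f ∘ suc) 0<Σ = suc i , 0<fi

  sum≡0 : ∀ {n} {f : Fin n → ℕ} → (∀ i → f i ≡ 0) → sum f ≡ 0
  sum≡0 {zero} _ = refl
  sum≡0 {suc n} f≡0 = cong₂ _+_ (f≡0 zero) (sum≡0 (f≡0 ∘ suc))

  sum≤1 : ∀ {n} (f : Fin n → ℕ) → (∀ i → f i ≤ 1) → (∀ i j → 0 < f i → 0 < f j → i ≡ j) → sum f ≤ 1
  sum≤1 {zero} f _ _ = z≤n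
  sum≤1 {suc n} f f≤1 single with f zero in f0≡
  ... | zero = sum≤1 (f ∘ suc) (f≤1 ∘ suc) (λ i j p q → Fin.suc-injective (single (suc i) (suc j) p q))
  ... | suc k = ≤-trans (≤-reflexive (trans (cong (suc k +_) rest≡0) (+-identityʳ (suc k))))
                        (subst (_≤ 1) f0≡ (f≤1 zero))
    where
    0<f0 : 0 < f zero
    0<f0 = subst (0 <_) (sym f0≡) (s≤s z≤n)
    rest≡0 : sum (f ∘ suc) ≡ 0
    rest≡0 = sum≡0 λ i → n≤0⇒n≡0 (≮⇒≥ (Fin.0≢1+n ∘ single zero (suc i) 0<f0))

module Parity where

  open import Data.Nat using (ℕ; zero; suc; _+_; _*_; _<_; z≤n; s≤s)
  open import Data.Nat.Properties using (+-suc)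
  open import Data.Bool using (Bool; true; false; not; _∧_; _xor_)
  open import Data.Bool.Properties using (not-distribˡ-xor; xor-same; xor-identityʳ; not-involutive)
  open import Data.Product using (∃; _,_)
  open import Relation.Binary.PropositionalEquality

  isOdd : ℕ → Bool
  isOdd zero = false
  isOdd (suc n) = not (isOdd n)

  isOdd-+ : ∀ m n → isOdd (m + n) ≡ isOdd m xor isOdd n
  isOdd-+ zero n = refl
  isOdd-+ (suc m) n = trans (cong not (isOdd-+ m n)) (not-distribˡ-xor (isOdd m) (isOdd n))

  isOdd-* : ∀ m n → isOdd (m * n) ≡ isOdd m ∧ isOdd n
  isOdd-* zero n = refl
  isOdd-* (suc m) n = trans (isOdd-+ n (m * n)) (trans (cong (isOdd n xor_) (isOdd-* m n)) (xor-∧ (isOdd m) (isOdd n)))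
    where
    xor-∧ : ∀ a b → b xor (a ∧ b) ≡ not a ∧ b
    xor-∧ true true = refl
    xor-∧ true false = refl
    xor-∧ false b = xor-identityʳ b

  isOdd-double : ∀ m → isOdd (m + m) ≡ false
  isOdd-double m = trans (isOdd-+ m m) (xor-same (isOdd m))

  isOdd-pred : ∀ j {b} → isOdd (suc j) ≡ b → isOdd j ≡ not b
  isOdd-pred j jp = trans (sym (not-involutive (isOdd j))) (cong not jp)

  isOdd⇒pos : ∀ j → isOdd j ≡ true → 0 < j
  isOdd⇒pos (suc j) _ = s≤s z≤n

  isOdd⇒∃ : ∀ j → isOdd j ≡ true → ∃ λ l → l + suc l ≡ j
  isOdd⇒∃ (suc zero) _ = 0 , refl
  isOdd⇒∃ (suc (suc j)) odd with l , l+1+l≡j ← isOdd⇒∃ j (trans (sym (not-involutive _)) odd)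
    = suc l , cong suc (trans (+-suc l (suc l)) (cong suc l+1+l≡j))

  isOdd-shift : ∀ {j} → isOdd j ≡ false → ∀ i → isOdd (j + i) ≡ isOdd i
  isOdd-shift {j} j-even i = trans (isOdd-+ j i) (cong (_xor isOdd i) j-even)

module Counting where

  open Sums
  open import Data.Nat using (ℕ; zero; suc; _+_; _≤_; _<_; z≤n)
  open import Data.Nat.Properties hiding (_≟_)
  open import Data.Nat.Tactic.RingSolver using (solve-∀)
  open import Data.Fin using (Fin; zero; suc; _≟_)
  open import Data.Bool using (Bool; true; not; _∧_)
  open import Data.Bool.Properties using (∧-identityʳ)
  open import Data.List using (List; []; _∷_; length; filter; filterᵇ; allFin; tabulate)
  open import Relation.Unary using (Pred; Decidable)
  open import Level using (0ℓ)
  open import Data.List.Relation.Unary.All as All using (All; []; _∷_)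
  open import Data.List.Relation.Unary.Unique.Propositional using (Unique; []; _∷_)
  open import Data.Product using (∃; _,_; uncurry)
  open import Relation.Nullary using (yes; no; contradiction)
  open import Relation.Nullary.Decidable using (⌊_⌋; T?; isYes≗does)
  open import Relation.Binary.PropositionalEquality
  open import Function using (_∘_; id)

  sum-symmetric-double : ∀ {n} (f : Fin n → Fin n → ℕ) → (∀ i j → f i j ≡ f j i) → (∀ i → f i i ≡ 0) →
    ∃ λ k → ∑[ i < n ] ∑[ j < n ] f i j ≡ k + k
  sum-symmetric-double {zero} f _ _ = 0 , refl
  sum-symmetric-double {suc n} f sym-f diag with k , ∑∑≡k+k ←
      sum-symmetric-double (λ i j → f (suc i) (suc j)) (λ i j → sym-f (suc i) (suc j)) (diag ∘ suc)
    = row + k , (begin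
      f zero zero + row + ∑[ i < n ] (f (suc i) zero + ∑[ j < n ] f (suc i) (suc j))
        ≡⟨ cong₂ _+_ (cong (_+ row) (diag zero)) (∑-distrib-+ (λ i → f (suc i) zero) _) ⟩
      row + (∑[ i < n ] f (suc i) zero + ∑[ i < n ] ∑[ j < n ] f (suc i) (suc j))
        ≡⟨ cong₂ (λ a b → row + (a + b)) (sum-cong-≗ (λ i → sym-f (suc i) zero)) ∑∑≡k+k ⟩
      row + (row + (k + k))
        ≡⟨ regroup row k ⟩
      row + k + (row + k) ∎)
    where
    open ≡-Reasoning
    row = ∑[ j < n ] f zero (suc j)
    regroup : ∀ a b → a + (a + (b + b)) ≡ a + b + (a + b)
    regroup = solve-∀

  count-filter : ∀ {n} {P : Pred (Fin n) 0ℓ} (P? : Decidable P) → length (filter P? (allFin n)) ≡ ∑[ i < n ] 𝟙 ⌊ P? i ⌋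
  count-filter {n} P? = go id
    where
    go : ∀ {m} (g : Fin m → Fin n) → length (filter P? (tabulate g)) ≡ ∑[ i < m ] 𝟙 ⌊ P? (g i) ⌋
    go {zero} g = refl
    go {suc m} g with P? (g zero)
    ... | yes _ = cong suc (go (g ∘ suc))
    ... | no _ = go (g ∘ suc)

  count-filterᵇ : ∀ {n} (p : Fin n → Bool) → length (filterᵇ p (allFin n)) ≡ ∑[ i < n ] 𝟙 (p i)
  count-filterᵇ p = trans (count-filter (T? ∘ p)) (sum-cong-≗ λ i → cong 𝟙 (isYes≗does (T? (p i))))

  sum-indicator : ∀ {n} (a : Fin n) → ∑[ i < n ] 𝟙 ⌊ i ≟ a ⌋ ≡ 1
  sum-indicator {suc n} zero = cong suc (sum≡0 {n} λ _ → refl)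
  sum-indicator {suc n} (suc a) = trans (sum-cong-≗ shift) (sum-indicator a)
    where
    shift : ∀ i → 𝟙 ⌊ suc i ≟ suc a ⌋ ≡ 𝟙 ⌊ i ≟ a ⌋
    shift i with i ≟ a
    ... | yes _ = refl
    ... | no _ = refl

  count-remove : ∀ {n} (p : Fin n → Bool) {a} → p a ≡ true →
    ∑[ i < n ] 𝟙 (p i) ≡ ∑[ i < n ] 𝟙 (p i ∧ not ⌊ i ≟ a ⌋) + 1
  count-remove {n} p {a} pa = begin
    ∑[ i < n ] 𝟙 (p i)                                          ≡⟨ sum-cong-≗ split ⟩
    ∑[ i < n ] (𝟙 (p′ i) + 𝟙 ⌊ i ≟ a ⌋)                         ≡⟨ ∑-distrib-+ (λ i → 𝟙 (p′ i)) (λ i → 𝟙 ⌊ i ≟ a ⌋) ⟩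
    ∑[ i < n ] 𝟙 (p′ i) + ∑[ i < n ] 𝟙 ⌊ i ≟ a ⌋                ≡⟨ cong (∑[ i < n ] 𝟙 (p′ i) +_) (sum-indicator a) ⟩
    ∑[ i < n ] 𝟙 (p′ i) + 1                                     ∎
    where
    open ≡-Reasoning
    p′ : Fin n → Bool
    p′ i = p i ∧ not ⌊ i ≟ a ⌋
    split : ∀ i → 𝟙 (p i) ≡ 𝟙 (p′ i) + 𝟙 ⌊ i ≟ a ⌋
    split i with i ≟ a
    ... | yes refl rewrite pa = refl
    ... | no _ = sym (trans (+-identityʳ _) (cong 𝟙 (∧-identityʳ (p i))))

  length≤count : ∀ {n} (p : Fin n → Bool) {l : List (Fin n)} → Unique l → All (λ x → p x ≡ true) l →
    length l ≤ ∑[ i < n ] 𝟙 (p i)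
  length≤count p [] [] = z≤n
  length≤count {n} p {x ∷ l} (x∉l ∷ unique) (px ∷ all-p) = begin
    suc (length l)                           ≡⟨ +-comm 1 (length l) ⟩
    length l + 1                             ≤⟨ +-monoˡ-≤ 1 (length≤count p′ unique (All.zipWith (uncurry keep) (x∉l , all-p))) ⟩
    ∑[ i < n ] 𝟙 (p′ i) + 1                  ≡⟨ count-remove p px ⟨
    ∑[ i < n ] 𝟙 (p i)                       ∎
    where
    open ≤-Reasoning
    p′ : Fin n → Bool
    p′ i = p i ∧ not ⌊ i ≟ x ⌋
    keep : ∀ {y} → x ≢ y → p y ≡ true → p′ y ≡ true
    keep {y} x≢y py with y ≟ x
    ... | yes y≡x = contradiction (sym y≡x) x≢y
    ... | no _ = trans (∧-identityʳ (p y)) py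

module GraphBasics where

  open Sums
  open Parity
  open Counting
  open import Data.Nat using (ℕ; _+_; _*_)
  open import Data.Fin using (Fin; _≟_)
  open import Data.Bool using (Bool; true; false)
  import Data.Bool.Properties as Bool
  open import Data.Product using (∃₂; _×_; _,_)
  open import Relation.Nullary using (yes; no; contradiction)
  open import Relation.Binary.PropositionalEquality
  open import Function using (_∘_)

  walk-crossing : ∀ {n} {a : Fin n → Fin n → Bool} (C : Fin n → Bool) {p q} → Walk a p q →
    C p ≡ true → C q ≡ false → ∃₂ λ u v → C u ≡ true × C v ≡ false × a u v ≡ true
  walk-crossing C nil Cp Cq = contradiction (trans (sym Cp) Cq) λ ()
  walk-crossing C {p} (cons {v = v} pv walk) Cp Cq with C v in Cv
  ... | true = walk-crossing C walk Cv Cq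
  ... | false = p , v , Cp , Cv , pv

  module _ {n : ℕ} (G : SimpleGraph n) where

    deleteEdge⇒adj : ∀ {x y u v} → deleteEdge G x y u v ≡ true → Adj G u v
    deleteEdge⇒adj {u = u} {v} e with adj G u v
    ... | true = refl
    ... | false = e

    deleteEdge-deleted : ∀ x y → deleteEdge G x y x y ≡ false
    deleteEdge-deleted x y with x ≟ x | y ≟ y
    ... | yes _ | yes _ = Bool.∧-zeroʳ (adj G x y)
    ... | no x≢x | _ = contradiction refl x≢x
    ... | yes _ | no y≢y = contradiction refl y≢y

    cubic-degree : Cubic G → ∀ u → ∑[ v < n ] 𝟙 (adj G u v) ≡ 3
    cubic-degree cubic u = trans (sym (count-filterᵇ (adj G u))) (cubic u)

    cubic⇒even : Cubic G → isOdd n ≡ false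
    cubic⇒even cubic with k , ∑∑≡k+k ← sum-symmetric-double (λ u v → 𝟙 (adj G u v))
                                          (λ u v → cong 𝟙 (SimpleGraph.sym G u v)) (λ u → cong 𝟙 (loopless G u)) =
      begin
      isOdd n                                       ≡⟨ trans (isOdd-* n 3) (Bool.∧-identityʳ (isOdd n)) ⟨
      isOdd (n * 3)                                 ≡⟨ cong isOdd (sum-const n 3) ⟨
      isOdd (∑[ u < n ] 3)                          ≡⟨ cong isOdd (sum-cong-≗ (sym ∘ cubic-degree cubic)) ⟩
      isOdd (∑[ u < n ] ∑[ v < n ] 𝟙 (adj G u v))   ≡⟨ cong isOdd ∑∑≡k+k ⟩
      isOdd (k + k)                                 ≡⟨ isOdd-double k ⟩
      false                                         ∎
      where open ≡-Reasoning

module Supergraphs where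

  open Sums
  open import Data.Nat using (ℕ; _≤_; _<_; z≤n; s≤s)
  open import Data.Fin using (Fin; _≟_)
  open import Data.Fin.Properties using (all?; ¬∀⟶∃¬)
  open import Data.Bool using (Bool; true; false; not; _∧_; _∨_)
  import Data.Bool.Properties as Bool
  open import Data.Bool.Properties using (∨-comm; ∧-comm)
  open import Data.Product using (∃; _×_; _,_)
  open import Data.Sum using (_⊎_; inj₁; inj₂)
  open import Relation.Nullary using (¬_; Dec; yes; no; contradiction; ¬?; _→-dec_)
  open import Relation.Nullary.Decidable using (⌊_⌋)
  open import Relation.Unary using (Pred; Decidable)
  open import Relation.Binary.PropositionalEquality
  open import Level using (0ℓ)

  module _ {n : ℕ} where

    _⊆_ : SimpleGraph n → SimpleGraph n → Set
    G ⊆ H = ∀ u v → Adj G u v → Adj H u v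

    isEdge : Fin n → Fin n → Fin n → Fin n → Bool
    isEdge a b u v = (⌊ u ≟ a ⌋ ∧ ⌊ v ≟ b ⌋) ∨ (⌊ u ≟ b ⌋ ∧ ⌊ v ≟ a ⌋)

    isEdge-sym : ∀ a b u v → isEdge a b u v ≡ isEdge a b v u
    isEdge-sym a b u v =
      trans (cong₂ _∨_ (∧-comm ⌊ u ≟ a ⌋ ⌊ v ≟ b ⌋) (∧-comm ⌊ u ≟ b ⌋ ⌊ v ≟ a ⌋))
            (∨-comm (⌊ v ≟ b ⌋ ∧ ⌊ u ≟ a ⌋) (⌊ v ≟ a ⌋ ∧ ⌊ u ≟ b ⌋))

    isEdge⁻ : ∀ {a b u v} → isEdge a b u v ≡ true → (u ≡ a × v ≡ b) ⊎ (u ≡ b × v ≡ a)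
    isEdge⁻ {a} {b} {u} {v} e with u ≟ a | v ≟ b | u ≟ b | v ≟ a
    ... | yes u≡a | yes v≡b | _ | _ = inj₁ (u≡a , v≡b)
    ... | _ | _ | yes u≡b | yes v≡a = inj₂ (u≡b , v≡a)
    ... | no _ | _ | no _ | _ = contradiction e λ ()
    ... | no _ | _ | yes _ | no _ = contradiction e λ ()
    ... | yes _ | no _ | no _ | _ = contradiction e λ ()
    ... | yes _ | no _ | yes _ | no _ = contradiction e λ ()

    isEdge-loop : ∀ {a b} → a ≢ b → ∀ v → isEdge a b v v ≡ false
    isEdge-loop {a} {b} a≢b v with isEdge a b v v in e
    ... | false = refl
    ... | true with isEdge⁻ {a} {b} {v} {v} e
    ... | inj₁ (v≡a , v≡b) = contradiction (trans (sym v≡a) v≡b) a≢b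
    ... | inj₂ (v≡b , v≡a) = contradiction (trans (sym v≡a) v≡b) a≢b

    addEdge : (H : SimpleGraph n) (a b : Fin n) → a ≢ b → SimpleGraph n
    addEdge H a b a≢b = record
      { adj = λ u v → adj H u v ∨ isEdge a b u v
      ; sym = λ u v → cong₂ _∨_ (SimpleGraph.sym H u v) (isEdge-sym a b u v)
      ; loopless = λ v → cong₂ _∨_ (loopless H v) (isEdge-loop a≢b v)
      }

    module _ {H : SimpleGraph n} {a b : Fin n} {a≢b : a ≢ b} where

      ⊆-addEdge : H ⊆ addEdge H a b a≢b
      ⊆-addEdge u v uv rewrite uv = refl

      addEdge-adj : Adj (addEdge H a b a≢b) a b
      addEdge-adj with adj H a b
      ... | true = refl
      ... | false with a ≟ a | b ≟ b
      ... | yes _ | yes _ = refl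
      ... | no a≢a | _ = contradiction refl a≢a
      ... | yes _ | no b≢b = contradiction refl b≢b

      addEdge-adj⁻ : ∀ {u v} → Adj (addEdge H a b a≢b) u v → Adj H u v ⊎ (u ≡ a × v ≡ b) ⊎ (u ≡ b × v ≡ a)
      addEdge-adj⁻ {u} {v} e with adj H u v
      ... | true = inj₁ refl
      ... | false = inj₂ (isEdge⁻ e)

    Universal : SimpleGraph n → Pred (Fin n) 0ℓ
    Universal H v = ∀ u → u ≢ v → Adj H v u

    private
      adjacentUnlessSelf? : ∀ (H : SimpleGraph n) v u → Dec (u ≢ v → Adj H v u)
      adjacentUnlessSelf? H v u = ¬? (u ≟ v) →-dec (adj H v u Bool.≟ true)

    universal? : ∀ H → Decidable (Universal H)
    universal? H v = all? (adjacentUnlessSelf? H v)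

    nonNeighbour : ∀ {H : SimpleGraph n} {y} → ¬ Universal H y → ∃ λ w → y ≢ w × adj H y w ≡ false
    nonNeighbour {H} {y} ¬Uy with w , ¬w↦y ← ¬∀⟶∃¬ n (λ u → u ≢ y → Adj H y u) (adjacentUnlessSelf? H y) ¬Uy =
      w , (λ y≡w → ¬w↦y λ w≢y → contradiction (sym y≡w) w≢y) , y≁w
      where
      y≁w : adj H y w ≡ false
      y≁w with adj H y w
      ... | true = contradiction (λ _ → refl) ¬w↦y
      ... | false = refl

    nonEdges : SimpleGraph n → ℕ
    nonEdges H = ∑[ u < n ] ∑[ v < n ] 𝟙 (not (adj H u v))

    addEdge-nonEdges : ∀ H {a b} (a≢b : a ≢ b) → adj H a b ≡ false → nonEdges (addEdge H a b a≢b) < nonEdges H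
    addEdge-nonEdges H {a} {b} a≢b a≁b =
      sum-mono-< (λ u → sum-mono-≤ (fewer u)) a (sum-mono-< (fewer a) b strict)
      where
      H′ = addEdge H a b a≢b
      fewer : ∀ u v → 𝟙 (not (adj H′ u v)) ≤ 𝟙 (not (adj H u v))
      fewer u v = 𝟙-not-antitone (⊆-addEdge {H} {a} {b} {a≢b} u v)
      strict : 𝟙 (not (adj H′ a b)) < 𝟙 (not (adj H a b))
      strict rewrite addEdge-adj {H} {a} {b} {a≢b} | a≁b = s≤s z≤n

module Matchings where

  open Supergraphs
  open import Data.Nat using (ℕ)
  open import Data.Fin using (Fin)
  open import Data.Sum using (inj₁; inj₂)
  open import Data.Product using (_,_)
  open import Relation.Nullary using (¬_; yes; no; contradiction)
  open import Relation.Unary using (Pred; Decidable; ∁)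
  open import Relation.Binary.PropositionalEquality
  open import Level using (0ℓ)

  module _ {n : ℕ} where

    record PerfectMatching (H : SimpleGraph n) : Set where
      field
        mate : Fin n → Fin n
        mate-mate : ∀ v → mate (mate v) ≡ v
        mate-≢ : ∀ v → mate v ≢ v
        mate-adj : ∀ v → Adj H v (mate v)

    record PerfectMatchingOn (H : SimpleGraph n) (S : Pred (Fin n) 0ℓ) : Set where
      field
        mate : Fin n → Fin n
        mate-∈ : ∀ {v} → S v → S (mate v)
        mate-mate : ∀ {v} → S v → mate (mate v) ≡ v
        mate-≢ : ∀ {v} → S v → mate v ≢ v
        mate-adj : ∀ {v} → S v → Adj H v (mate v)

    module _ {H K : SimpleGraph n} {S : Pred (Fin n) 0ℓ} (M : PerfectMatching K) where
      open PerfectMatching M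

      restrictTo : (∀ {v} → S v → S (mate v)) → (∀ {v} → S v → Adj H v (mate v)) → PerfectMatchingOn H S
      restrictTo closed adjH = record
        { mate = mate ; mate-∈ = closed ; mate-mate = λ _ → mate-mate _ ; mate-≢ = λ _ → mate-≢ _ ; mate-adj = adjH }

      restrictToComplement : (∀ {v} → S v → S (mate v)) → (∀ {v} → ¬ S v → Adj H v (mate v)) →
        PerfectMatchingOn H (∁ S)
      restrictToComplement closed adjH = record
        { mate = mate
        ; mate-∈ = λ {v} v∉S mate∈S → v∉S (subst S (mate-mate v) (closed mate∈S))
        ; mate-mate = λ _ → mate-mate _
        ; mate-≢ = λ _ → mate-≢ _
        ; mate-adj = adjH
        }

    splice : ∀ {H S} → Decidable S → PerfectMatchingOn H S → PerfectMatchingOn H (∁ S) → PerfectMatching H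
    splice {H} {S} S? M N = record { mate = mate ; mate-mate = mate-mate ; mate-≢ = mate-≢ ; mate-adj = mate-adj }
      where
      module M = PerfectMatchingOn M
      module N = PerfectMatchingOn N
      mate : Fin n → Fin n
      mate v with S? v
      ... | yes _ = M.mate v
      ... | no _ = N.mate v
      mate-in : ∀ {v} → S v → mate v ≡ M.mate v
      mate-in {v} v∈S with S? v
      ... | yes _ = refl
      ... | no v∉S = contradiction v∈S v∉S
      mate-out : ∀ {v} → ¬ S v → mate v ≡ N.mate v
      mate-out {v} v∉S with S? v
      ... | yes v∈S = contradiction v∈S v∉S
      ... | no _ = refl
      mate-mate : ∀ v → mate (mate v) ≡ v
      mate-mate v with S? v
      ... | yes v∈S = trans (mate-in (M.mate-∈ v∈S)) (M.mate-mate v∈S)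
      ... | no v∉S = trans (mate-out (N.mate-∈ v∉S)) (N.mate-mate v∉S)
      mate-≢ : ∀ v → mate v ≢ v
      mate-≢ v with S? v
      ... | yes v∈S = M.mate-≢ v∈S
      ... | no v∉S = N.mate-≢ v∉S
      mate-adj : ∀ v → Adj H v (mate v)
      mate-adj v with S? v
      ... | yes v∈S = M.mate-adj v∈S
      ... | no v∉S = N.mate-adj v∉S

    unaddEdge : ∀ {H a b a≢b} (M : PerfectMatching (addEdge H a b a≢b)) → PerfectMatching.mate M a ≢ b → PerfectMatching H
    unaddEdge {H} {a} {b} {a≢b} M a↛b = record { mate = mate ; mate-mate = mate-mate ; mate-≢ = mate-≢ ; mate-adj = adjH }
      where
      open PerfectMatching M
      adjH : ∀ v → Adj H v (mate v)
      adjH v with addEdge-adj⁻ {H = H} {a≢b = a≢b} (mate-adj v)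
      ... | inj₁ vm = vm
      ... | inj₂ (inj₁ (refl , m≡b)) = contradiction m≡b a↛b
      ... | inj₂ (inj₂ (refl , m≡a)) = contradiction (trans (cong mate (sym m≡a)) (mate-mate v)) a↛b

module MatchingToColoring where

  open Sums
  open Counting
  open GraphBasics
  open Matchings
  open import Data.Nat using (ℕ; _+_; _<_; z≤n; s≤s)
  open import Data.Nat.Properties using (+-cancelʳ-≡; <-irrefl; ≤-trans; ≤-reflexive)
  open import Data.Fin using (Fin; _≟_)
  open import Data.Bool using (Bool; true; not; _∧_)
  open import Data.List using (_∷_; [])
  open import Data.List.Relation.Unary.All using (_∷_; [])
  open import Data.List.Relation.Unary.Unique.Propositional using (_∷_; [])
  open import Data.Product using (Σ; ∃; _×_; _,_; proj₁; proj₂)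
  open import Relation.Nullary using (Dec; yes; no; contradiction)
  open import Relation.Nullary.Decidable using (⌊_⌋)
  open import Relation.Binary.PropositionalEquality
  open import Data.Empty using (⊥)
  open import Function using (_∘_)

  _≟₃_ : (a b : M3) → Dec (a ≡ b)
  zero ≟₃ zero = yes refl
  zero ≟₃ one = no λ ()
  zero ≟₃ minusOne = no λ ()
  one ≟₃ zero = no λ ()
  one ≟₃ one = yes refl
  one ≟₃ minusOne = no λ ()
  minusOne ≟₃ zero = no λ ()
  minusOne ≟₃ one = no λ ()
  minusOne ≟₃ minusOne = yes refl

  edgeSign : M3 → M3 → Sign
  edgeSign a b with a ≟₃ b
  ... | yes _ = minus
  ... | no _ = plus

  edgeSign-comm : ∀ a b → edgeSign a b ≡ edgeSign b a
  edgeSign-comm a b with a ≟₃ b | b ≟₃ a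
  ... | yes _ | yes _ = refl
  ... | no _ | no _ = refl
  ... | yes a≡b | no b≢a = contradiction (sym a≡b) b≢a
  ... | no a≢b | yes b≡a = contradiction (sym b≡a) a≢b

  edgeSign-law : ∀ {a b} → a ≢ zero → b ≢ zero → a ≡ negM (edgeSign a b · b)
  edgeSign-law {zero} a≢0 _ = contradiction refl a≢0
  edgeSign-law {_} {zero} _ b≢0 = contradiction refl b≢0
  edgeSign-law {one} {one} _ _ = refl
  edgeSign-law {one} {minusOne} _ _ = refl
  edgeSign-law {minusOne} {one} _ _ = refl
  edgeSign-law {minusOne} {minusOne} _ _ = refl

  zero-law : ∀ s → zero ≡ negM (s · zero)
  zero-law plus = refl
  zero-law minus = refl

  module _ {n : ℕ} {G : SimpleGraph n} (cubic : Cubic G) (M : PerfectMatching G) where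
    open PerfectMatching M

    other : Fin n → Fin n → Bool
    other v u = adj G v u ∧ not ⌊ u ≟ mate v ⌋

    other⁺ : ∀ {v u} → Adj G v u → u ≢ mate v → other v u ≡ true
    other⁺ {v} {u} vu u≢m rewrite vu with u ≟ mate v
    ... | yes u≡m = contradiction u≡m u≢m
    ... | no _ = refl

    count-other : ∀ v → ∑[ u < n ] 𝟙 (other v u) ≡ 2
    count-other v = +-cancelʳ-≡ 1 _ 2 (sym (begin
      3                            ≡⟨ cubic-degree G cubic v ⟨
      ∑[ u < n ] 𝟙 (adj G v u)     ≡⟨ count-remove (adj G v) (mate-adj v) ⟩
      ∑[ u < n ] 𝟙 (other v u) + 1 ∎))
      where open ≡-Reasoning

    otherExists : ∀ v → ∃ λ u → other v u ≡ true
    otherExists v =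
      let u , 0<𝟙 = sum-pos⇒term-pos (λ u → 𝟙 (other v u)) (subst (0 <_) (sym (count-other v)) (s≤s z≤n))
      in u , 𝟙-pos 0<𝟙

    chosenOther : Fin n → Fin n
    chosenOther v = proj₁ (otherExists v)

    three-others : ∀ {v a b c} → other v a ≡ true → other v b ≡ true → other v c ≡ true →
      a ≢ b → a ≢ c → b ≢ c → ⊥
    three-others {v} {a} {b} {c} oa ob oc a≢b a≢c b≢c =
      <-irrefl refl (≤-trans
        (length≤count (other v) ((a≢b ∷ a≢c ∷ []) ∷ (b≢c ∷ []) ∷ [] ∷ []) (oa ∷ ob ∷ oc ∷ []))
        (≤-reflexive (count-other v)))

    color : Fin n → Fin n → M3
    color v w with w ≟ mate v | w ≟ chosenOther v
    ... | yes _ | _ = zero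
    ... | no _ | yes _ = one
    ... | no _ | no _ = minusOne

    color-zero⁻ : ∀ {v w} → color v w ≡ zero → w ≡ mate v
    color-zero⁻ {v} {w} c with w ≟ mate v | w ≟ chosenOther v
    color-zero⁻ _ | yes w≡m | _ = w≡m
    color-zero⁻ () | no _ | yes _
    color-zero⁻ () | no _ | no _

    color-one⁻ : ∀ {v w} → color v w ≡ one → w ≡ chosenOther v
    color-one⁻ {v} {w} c with w ≟ mate v | w ≟ chosenOther v
    color-one⁻ () | yes _ | _
    color-one⁻ _ | no _ | yes w≡o = w≡o
    color-one⁻ () | no _ | no _

    color-minusOne⁻ : ∀ {v w} → color v w ≡ minusOne → w ≢ mate v × w ≢ chosenOther v
    color-minusOne⁻ {v} {w} c with w ≟ mate v | w ≟ chosenOther v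
    color-minusOne⁻ () | yes _ | _
    color-minusOne⁻ () | no _ | yes _
    color-minusOne⁻ _ | no w≢m | no w≢o = w≢m , w≢o

    color-nonzero : ∀ {v w} → w ≢ mate v → color v w ≢ zero
    color-nonzero w≢m c = w≢m (color-zero⁻ c)

    color-mate : ∀ {v w} → w ≡ mate v → color v w ≡ zero
    color-mate {v} {w} w≡m with w ≟ mate v
    ... | yes _ = refl
    ... | no w≢m = contradiction w≡m w≢m

    mate-sym : ∀ {v w} → w ≡ mate v → v ≡ mate w
    mate-sym {v} w≡m = trans (sym (mate-mate v)) (cong mate (sym w≡m))

    signature : Signature G
    signature = (λ v w → edgeSign (color v w) (color w v)) , λ v w _ → edgeSign-comm (color v w) (color w v)

    color-isColoring : IsColoring G (proj₁ signature) color
    color-isColoring v w _ = law (w ≟ mate v)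
      where
      law : Dec (w ≡ mate v) → color v w ≡ negM (proj₁ signature v w · color w v)
      law (yes w≡m) = subst₂ (λ a b → a ≡ negM (edgeSign a b · b))
        (sym (color-mate w≡m)) (sym (color-mate (mate-sym w≡m))) (zero-law (edgeSign zero zero))
      law (no w≢m) = edgeSign-law (color-nonzero w≢m) (color-nonzero (w≢m ∘ mate-sym))

    color-isProper : IsProper G color
    color-isProper v w u vw vu w≢u same with color v w in cw
    ... | zero = w≢u (trans (color-zero⁻ cw) (sym (color-zero⁻ (sym same))))
    ... | one = w≢u (trans (color-one⁻ cw) (sym (color-one⁻ (sym same))))
    ... | minusOne with w≢m , w≢o ← color-minusOne⁻ cw | u≢m , u≢o ← color-minusOne⁻ (sym same) =
      three-others (other⁺ vw w≢m) (other⁺ vu u≢m) (proj₂ (otherExists v)) w≢u w≢o u≢o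

  perfectMatching⇒coloring : ∀ {n} {G : SimpleGraph n} → Cubic G → PerfectMatching G →
    Σ (Signature G) λ σ → HasProper3EdgeColoring G σ
  perfectMatching⇒coloring cubic M =
    signature cubic M , color cubic M , color-isColoring cubic M , color-isProper cubic M

module AlternatingWalks where

  open Parity
  open import Data.Nat using (ℕ; zero; suc; _+_; _<_; z≤n; s≤s; s≤s⁻¹)
  open import Data.Nat.Properties hiding (_≟_)
  open import Data.Fin using (Fin; toℕ; _≟_)
  import Data.Bool.Properties as Bool
  open import Data.Bool.Properties using (¬-not)
  open import Data.Fin.Properties using (pigeonhole)
  open import Data.Bool using (Bool; true; false; not; _xor_)
  open import Function using (_∘_)
  open import Data.Product using (∃; _×_; _,_)
  open import Data.Sum using (_⊎_; inj₁; inj₂; [_,_]′)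
  open import Relation.Nullary using (¬_; yes; no)
  open import Relation.Unary using (Pred; Decidable)
  open import Relation.Binary.PropositionalEquality
  open import Level using (0ℓ)

  first? : ∀ {P : Pred ℕ 0ℓ} → Decidable P → ∀ N →
    (∃ λ j → j < N × P j × (∀ i → i < j → ¬ P i)) ⊎ (∀ j → j < N → ¬ P j)
  first? P? zero = inj₂ λ _ ()
  first? P? (suc N) with first? P? N
  ... | inj₁ (j , j<N , Pj , before) = inj₁ (j , m≤n⇒m≤1+n j<N , Pj , before)
  ... | inj₂ none with P? N
  ... | yes PN = inj₁ (N , ≤-refl , PN , none)
  ... | no ¬PN = inj₂ λ j j<1+N → [ none j , (λ { refl → ¬PN }) ]′ (m≤n⇒m<n∨m≡n (s≤s⁻¹ j<1+N))

  module AlternatingWalk {n : ℕ} (m₁ m₂ : Fin n → Fin n)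
    (m₁-inv : ∀ v → m₁ (m₁ v) ≡ v) (m₂-inv : ∀ v → m₂ (m₂ v) ≡ v)
    (m₁-≢ : ∀ v → m₁ v ≢ v) (m₂-≢ : ∀ v → m₂ v ≢ v) (start : Fin n) where

    step : Bool → Fin n → Fin n
    step false = m₂
    step true = m₁

    step-inv : ∀ b v → step b (step b v) ≡ v
    step-inv false = m₂-inv
    step-inv true = m₁-inv

    step-≢ : ∀ b v → step b v ≢ v
    step-≢ false = m₂-≢
    step-≢ true = m₁-≢

    walk : ℕ → Fin n
    walk zero = start
    walk (suc j) = step (isOdd j) (walk j)

    walk-back : ∀ j → step (isOdd j) (walk (suc j)) ≡ walk j
    walk-back j = step-inv (isOdd j) (walk j)

    step-forward : ∀ j {b} → isOdd j ≡ b → step b (walk j) ≡ walk (suc j)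
    step-forward j refl = refl

    step-back : ∀ j {b} → isOdd j ≡ b → step b (walk (suc j)) ≡ walk j
    step-back j refl = walk-back j

    walk-shift : ∀ j → walk j ≡ start → isOdd j ≡ false → ∀ i → walk (j + i) ≡ walk i
    walk-shift j j↦start j-even zero = trans (cong walk (+-identityʳ j)) j↦start
    walk-shift j j↦start j-even (suc i) =
      trans (cong walk (+-suc j i)) (cong₂ step (isOdd-shift {j} j-even i) (walk-shift j j↦start j-even i))

    -- at an odd return time the walk retraces itself, which forces a fixed point of m₁ or m₂
    walk-reflect : ∀ j → walk j ≡ start → isOdd j ≡ true → ∀ i k → i + k ≡ j → walk k ≡ walk i
    walk-reflect j j↦start _ zero k refl = j↦start
    walk-reflect j j↦start j-odd (suc i) k i+k≡j = begin
      walk k                       ≡⟨ walk-back k ⟨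
      step (isOdd k) (walk (suc k)) ≡⟨ cong₂ step (sym same-parity) (walk-reflect j j↦start j-odd i (suc k) i+1+k≡j) ⟩
      step (isOdd i) (walk i)       ∎
      where
      open ≡-Reasoning
      i+1+k≡j : i + suc k ≡ j
      i+1+k≡j = trans (+-suc i k) i+k≡j
      same-parity : isOdd i ≡ isOdd k
      same-parity = flip (isOdd i) (isOdd k) (trans (sym (isOdd-+ (suc i) k)) (trans (cong isOdd i+k≡j) j-odd))
        where
        flip : ∀ a b → not a xor b ≡ true → a ≡ b
        flip false false _ = refl
        flip true true _ = refl

    walk-double-suc : ∀ k → walk (suc k + suc k) ≡ m₁ (m₂ (walk (k + k)))
    walk-double-suc k = begin
      walk (suc k + suc k)
        ≡⟨ cong (walk ∘ suc) (+-suc k k) ⟩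
      step (not (isOdd (k + k))) (step (isOdd (k + k)) (walk (k + k)))
        ≡⟨ cong (λ b → step (not b) (step b (walk (k + k)))) (isOdd-double k) ⟩
      m₁ (m₂ (walk (k + k))) ∎
      where open ≡-Reasoning

    walk-double-injective : ∀ a b → walk (suc a + suc a) ≡ walk (suc b + suc b) → walk (a + a) ≡ walk (b + b)
    walk-double-injective a b eq = begin
      walk (a + a)                       ≡⟨ m₂-inv _ ⟨
      m₂ (m₂ (walk (a + a)))             ≡⟨ cong m₂ (m₁-inv _) ⟨
      m₂ (m₁ (m₁ (m₂ (walk (a + a)))))   ≡⟨ cong (m₂ ∘ m₁) (trans (sym (walk-double-suc a)) (trans eq (walk-double-suc b))) ⟩
      m₂ (m₁ (m₁ (m₂ (walk (b + b)))))   ≡⟨ cong m₂ (m₁-inv _) ⟩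
      m₂ (m₂ (walk (b + b)))             ≡⟨ m₂-inv _ ⟩
      walk (b + b)                       ∎
      where open ≡-Reasoning

    walk-returns : ∃ λ p → walk (suc p + suc p) ≡ start
    walk-returns =
      let i , j , i<j , eq = pigeonhole (n<1+n n) (λ (k : Fin (suc n)) → walk (toℕ k + toℕ k))
          p , 1+i+p≡j = m≤n⇒∃[o]m+o≡n i<j
      in p , sym (cancel (toℕ i) (trans eq (cong (λ k → walk (k + k)) (sym (trans (+-suc (toℕ i) p) 1+i+p≡j)))))
      where
      cancel : ∀ a {p} → walk (a + a) ≡ walk ((a + p) + (a + p)) → start ≡ walk (p + p)
      cancel zero eq = eq
      cancel (suc a) {p} eq = cancel a (walk-double-injective a (a + p) eq)

    module Cycle {p : ℕ} (returns : walk (suc p + suc p) ≡ start) where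

      P : ℕ
      P = suc p + suc p

      OnCycle : Pred (Fin n) 0ℓ
      OnCycle v = ∃ λ j → j < P × walk j ≡ v

      onCycle? : Decidable OnCycle
      onCycle? v = anyUpTo? (λ j → walk j ≟ v) P

      start-onCycle : OnCycle start
      start-onCycle = 0 , s≤s z≤n , refl

      forward : ∀ {j} → j < P → OnCycle (walk (suc j))
      forward {j} j<P with m≤n⇒m<n∨m≡n j<P
      ... | inj₁ 1+j<P = suc j , 1+j<P , refl
      ... | inj₂ 1+j≡P = 0 , s≤s z≤n , trans (sym returns) (cong walk (sym 1+j≡P))

      last-step : OnCycle (m₁ start)
      last-step = p + suc p , ≤-refl , (begin
        walk (p + suc p)                                   ≡⟨ walk-back (p + suc p) ⟨
        step (isOdd (p + suc p)) (walk (suc p + suc p))    ≡⟨ cong₂ step odd returns ⟩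
        m₁ start                                           ∎)
        where
        open ≡-Reasoning
        odd : isOdd (p + suc p) ≡ true
        odd = trans (cong isOdd (+-suc p p)) (cong not (isOdd-double p))

      onCycle-step : ∀ b {v} → OnCycle v → OnCycle (step b v)
      onCycle-step b (j , j<P , refl) with b Bool.≟ isOdd j
      ... | yes refl = forward j<P
      onCycle-step b (suc j , j<P , refl) | no b≢ =
        j , <-trans (n<1+n j) j<P , sym (trans (cong (λ c → step c (walk (suc j))) b≡) (walk-back j))
        where
        b≡ : b ≡ isOdd j
        b≡ = trans (¬-not b≢) (Bool.not-involutive (isOdd j))
      onCycle-step b (zero , _ , refl) | no b≢false rewrite ¬-not b≢false = last-step

module LovaszSwitching where

  open Parity
  open Supergraphs
  open Matchings
  open AlternatingWalks
  open import Data.Nat using (ℕ; zero; suc; _+_; _∸_; _≤_; _<_; z≤n; s≤s; s≤s⁻¹; _≤?_)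
  open import Data.Nat.Properties hiding (_≟_)
  open import Data.Fin using (Fin; _≟_)
  open import Data.Bool using (true; false; not)
  open import Data.Product using (∃; _×_; _,_)
  open import Data.Sum using (_⊎_; inj₁; inj₂)
  open import Relation.Nullary using (¬_; yes; no; contradiction; _×-dec_; _⊎-dec_)
  open import Relation.Unary using (Pred; Decidable)
  open import Relation.Binary.PropositionalEquality
  open import Function using (_∘_)
  open import Level using (0ℓ)

  module Switching {n : ℕ} {H : SimpleGraph n} {x y z w : Fin n} {x≢z : x ≢ z} {y≢w : y ≢ w}
    (xy : Adj H x y) (yz : Adj H y z) (y≁w : adj H y w ≡ false)
    (M₁ : PerfectMatching (addEdge H x z x≢z)) (M₂ : PerfectMatching (addEdge H y w y≢w))
    (m₁x≡z : PerfectMatching.mate M₁ x ≡ z) (m₂y≡w : PerfectMatching.mate M₂ y ≡ w) where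

    open PerfectMatching M₁ using () renaming (mate to m₁; mate-mate to m₁-inv; mate-≢ to m₁-≢; mate-adj to m₁-adj′)
    open PerfectMatching M₂ using () renaming (mate to m₂; mate-mate to m₂-inv; mate-≢ to m₂-≢; mate-adj to m₂-adj′)
    open AlternatingWalk m₁ m₂ m₁-inv m₂-inv m₁-≢ m₂-≢ y

    Ends : Pred (Fin n) 0ℓ
    Ends v = v ≡ x ⊎ v ≡ z

    ends? : Decidable Ends
    ends? v = (v ≟ x) ⊎-dec (v ≟ z)

    ends-m₁ : ∀ {v} → Ends v → Ends (m₁ v)
    ends-m₁ (inj₁ refl) = inj₂ m₁x≡z
    ends-m₁ (inj₂ refl) = inj₁ (trans (cong m₁ (sym m₁x≡z)) (m₁-inv x))

    adj-y-ends : ∀ {v} → Ends v → Adj H y v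
    adj-y-ends (inj₁ refl) = trans (SimpleGraph.sym H y x) xy
    adj-y-ends (inj₂ refl) = yz

    y∉ends : ¬ Ends y
    y∉ends e = contradiction (trans (sym (loopless H y)) (adj-y-ends e)) λ ()

    w∉ends : ¬ Ends w
    w∉ends e = contradiction (trans (sym y≁w) (adj-y-ends e)) λ ()

    m₁-adj : ∀ {v} → ¬ Ends v → Adj H v (m₁ v)
    m₁-adj {v} v∉ends with addEdge-adj⁻ {H = H} {a≢b = x≢z} (m₁-adj′ v)
    ... | inj₁ vm = vm
    ... | inj₂ (inj₁ (v≡x , _)) = contradiction (inj₁ v≡x) v∉ends
    ... | inj₂ (inj₂ (v≡z , _)) = contradiction (inj₂ v≡z) v∉ends

    m₂-adj : ∀ {v} → v ≢ y → v ≢ w → Adj H v (m₂ v)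
    m₂-adj {v} v≢y v≢w with addEdge-adj⁻ {H = H} {a≢b = y≢w} (m₂-adj′ v)
    ... | inj₁ vm = vm
    ... | inj₂ (inj₁ (v≡y , _)) = contradiction v≡y v≢y
    ... | inj₂ (inj₂ (v≡w , _)) = contradiction v≡w v≢w

    module CycleAvoidingEnds {p : ℕ} (returns : walk (suc p + suc p) ≡ y)
      (avoids : ∀ j → j < suc p + suc p → ¬ Ends (walk j)) where
      open Cycle {p} returns

      w-onCycle : OnCycle w
      w-onCycle = 1 , s≤s (≤-trans (s≤s z≤n) (m≤n+m (suc p) p)) , m₂y≡w

      matching : PerfectMatching H
      matching = splice onCycle?
        (restrictTo M₁ (onCycle-step true) λ { (j , j<P , refl) → m₁-adj (avoids j j<P) })
        (restrictToComplement M₂ (onCycle-step false)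
          λ v∉C → m₂-adj (λ { refl → v∉C start-onCycle }) (λ { refl → v∉C w-onCycle }))

    module PathToEnds (k : ℕ) (k-even : isOdd k ≡ false) (1≤k : 1 ≤ k)
      (hit : Ends (walk (suc k))) (before : ∀ i → i ≤ k → ¬ Ends (walk i)) where

      t : Fin n
      t = walk (suc k)

      Interior : Pred (Fin n) 0ℓ
      Interior v = ∃ λ j → j < suc k × 1 ≤ j × walk j ≡ v

      interior? : Decidable Interior
      interior? v = anyUpTo? (λ j → (1 ≤? j) ×-dec (walk j ≟ v)) (suc k)

      interior∌ends : ∀ {v} → Interior v → ¬ Ends v
      interior∌ends (j , j<1+k , _ , refl) = before j (s≤s⁻¹ j<1+k)

      -- returning to y at an even time would repeat the hit earlier; at an odd time m₁ or m₂ would fix a vertex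
      interior-walk≢y : ∀ {j} → 1 ≤ j → j ≤ k → walk j ≢ y
      interior-walk≢y {j} 1≤j j≤k j↦y with isOdd j in jp
      ... | false = before (suc k ∸ j) (∸-monoʳ-≤ (suc k) 1≤j) (subst Ends earlier hit)
        where
        earlier : walk (suc k) ≡ walk (suc k ∸ j)
        earlier = trans (cong walk (sym (m+[n∸m]≡n (m≤n⇒m≤1+n j≤k)))) (walk-shift j j↦y jp (suc k ∸ j))
      ... | true with l , l+1+l≡j ← isOdd⇒∃ j jp = step-≢ (isOdd l) (walk l) (walk-reflect j j↦y jp l (suc l) l+1+l≡j)

      y∉interior : ¬ Interior y
      y∉interior (j , j<1+k , 1≤j , j↦y) = interior-walk≢y 1≤j (s≤s⁻¹ j<1+k) j↦y

      t∉interior : ¬ Interior t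
      t∉interior t∈I = interior∌ends t∈I hit

      t≢y : t ≢ y
      t≢y t≡y = y∉ends (subst Ends t≡y hit)

      interior-m₁ : ∀ {v} → Interior v → Interior (m₁ v)
      interior-m₁ (j , j<1+k , 1≤j , refl) = go j j<1+k 1≤j (isOdd j) refl
        where
        go : ∀ j → j < suc k → 1 ≤ j → ∀ b → isOdd j ≡ b → Interior (m₁ (walk j))
        go j j<1+k _ true jp = suc j , s≤s (≤∧≢⇒< (s≤s⁻¹ j<1+k) j≢k) , s≤s z≤n , sym (step-forward j jp)
          where
          j≢k : j ≢ k
          j≢k refl = contradiction (trans (sym jp) k-even) λ ()
        go (suc j) j<1+k _ false jp =
          j , <-trans (n<1+n j) j<1+k , isOdd⇒pos j (isOdd-pred j jp) , sym (step-back j (isOdd-pred j jp))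

      Path : Pred (Fin n) 0ℓ
      Path v = Interior v ⊎ v ≡ y ⊎ v ≡ t

      path? : Decidable Path
      path? v = interior? v ⊎-dec (v ≟ y) ⊎-dec (v ≟ t)

      path-m₂ : ∀ {v} → Path v → Path (m₂ v)
      path-m₂ (inj₂ (inj₁ refl)) = inj₁ (1 , s≤s 1≤k , ≤-refl , refl)
      path-m₂ (inj₂ (inj₂ refl)) = inj₁ (k , ≤-refl , 1≤k , sym (step-back k k-even))
      path-m₂ (inj₁ (j , j<1+k , 1≤j , refl)) = go j j<1+k 1≤j (isOdd j) refl
        where
        go : ∀ j → j < suc k → 1 ≤ j → ∀ b → isOdd j ≡ b → Path (m₂ (walk j))
        go j j<1+k _ false jp with m≤n⇒m<n∨m≡n j<1+k
        ... | inj₁ 1+j<1+k = inj₁ (suc j , 1+j<1+k , s≤s z≤n , sym (step-forward j jp))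
        ... | inj₂ 1+j≡1+k = inj₂ (inj₂ (trans (step-forward j jp) (cong walk 1+j≡1+k)))
        go (suc zero) _ _ true _ = inj₂ (inj₁ (step-back 0 refl))
        go (suc (suc j)) j<1+k _ true jp =
          inj₁ (suc j , <-trans (n<1+n (suc j)) j<1+k , s≤s z≤n , sym (step-back (suc j) (isOdd-pred (suc j) jp)))

      path-y : Path y
      path-y = inj₂ (inj₁ refl)

      path-w : Path w
      path-w = inj₁ (1 , s≤s 1≤k , ≤-refl , m₂y≡w)

      rematch : PerfectMatchingOn H Path
      rematch = record { mate = f ; mate-∈ = f-∈ ; mate-mate = f-f ; mate-≢ = f-≢ ; mate-adj = f-adj }
        where
        f : Fin n → Fin n
        f v with interior? v | v ≟ y
        ... | yes _ | _ = m₁ v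
        ... | no _ | yes _ = t
        ... | no _ | no _ = y

        f-interior : ∀ {v} → Interior v → f v ≡ m₁ v
        f-interior {v} v∈I with interior? v
        ... | yes _ = refl
        ... | no v∉I = contradiction v∈I v∉I

        f-y : f y ≡ t
        f-y with interior? y | y ≟ y
        ... | yes y∈I | _ = contradiction y∈I y∉interior
        ... | no _ | yes _ = refl
        ... | no _ | no y≢y = contradiction refl y≢y

        f-t : f t ≡ y
        f-t with interior? t | t ≟ y
        ... | yes t∈I | _ = contradiction t∈I t∉interior
        ... | no _ | yes t≡y = contradiction t≡y t≢y
        ... | no _ | no _ = refl

        f-∈ : ∀ {v} → Path v → Path (f v)
        f-∈ (inj₁ v∈I) = inj₁ (subst Interior (sym (f-interior v∈I)) (interior-m₁ v∈I))
        f-∈ (inj₂ (inj₁ refl)) = inj₂ (inj₂ f-y)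
        f-∈ (inj₂ (inj₂ refl)) = inj₂ (inj₁ f-t)

        f-f : ∀ {v} → Path v → f (f v) ≡ v
        f-f (inj₁ v∈I) = trans (cong f (f-interior v∈I)) (trans (f-interior (interior-m₁ v∈I)) (m₁-inv _))
        f-f (inj₂ (inj₁ refl)) = trans (cong f f-y) f-t
        f-f (inj₂ (inj₂ refl)) = trans (cong f f-t) f-y

        f-≢ : ∀ {v} → Path v → f v ≢ v
        f-≢ (inj₁ v∈I) fv≡v = m₁-≢ _ (trans (sym (f-interior v∈I)) fv≡v)
        f-≢ (inj₂ (inj₁ refl)) fy≡y = t≢y (trans (sym f-y) fy≡y)
        f-≢ (inj₂ (inj₂ refl)) ft≡t = t≢y (sym (trans (sym f-t) ft≡t))

        f-adj : ∀ {v} → Path v → Adj H v (f v)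
        f-adj (inj₁ v∈I) = subst (Adj H _) (sym (f-interior v∈I)) (m₁-adj (interior∌ends v∈I))
        f-adj (inj₂ (inj₁ refl)) = subst (Adj H y) (sym f-y) (adj-y-ends hit)
        f-adj (inj₂ (inj₂ refl)) = subst (Adj H t) (sym f-t) (trans (SimpleGraph.sym H t y) (adj-y-ends hit))

      matching : PerfectMatching H
      matching = splice path? rematch
        (restrictToComplement M₂ path-m₂ λ v∉P → m₂-adj (λ { refl → v∉P path-y }) (λ { refl → v∉P path-w }))

    -- the first vertex of x, z met by the walk is reached by an m₂-step
    fromFirstHit : ∀ q → Ends (walk q) → (∀ i → i < q → ¬ Ends (walk i)) → PerfectMatching H
    fromFirstHit zero hit _ = contradiction hit y∉ends
    fromFirstHit (suc zero) hit _ = contradiction (subst Ends m₂y≡w hit) w∉ends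
    fromFirstHit (suc (suc j)) hit before = byParity (isOdd j) refl
      where
      byParity : ∀ b → isOdd j ≡ b → PerfectMatching H
      byParity true jp = PathToEnds.matching (suc j) (cong not jp) (s≤s z≤n) hit (λ i i≤1+j → before i (s≤s i≤1+j))
      byParity false jp =
        contradiction (subst Ends (step-back (suc j) (cong not jp)) (ends-m₁ hit)) (before (suc j) ≤-refl)

    fromReturn : ∀ p → walk (suc p + suc p) ≡ y → PerfectMatching H
    fromReturn p returns with first? (ends? ∘ walk) (suc p + suc p)
    ... | inj₁ (q , _ , hit , before) = fromFirstHit q hit before
    ... | inj₂ avoids = CycleAvoidingEnds.matching returns avoids

    matching : PerfectMatching H
    matching = let p , returns = walk-returns in fromReturn p returns

  switch : ∀ {n} {H : SimpleGraph n} {x y z w : Fin n} (x≢z : x ≢ z) (y≢w : y ≢ w) →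
    Adj H x y → Adj H y z → adj H y w ≡ false →
    PerfectMatching (addEdge H x z x≢z) → PerfectMatching (addEdge H y w y≢w) → PerfectMatching H
  switch {x = x} {y} {z} {w} x≢z y≢w xy yz y≁w M₁ M₂ with PerfectMatching.mate M₁ x ≟ z | PerfectMatching.mate M₂ y ≟ w
  ... | no m₁x≢z | _ = unaddEdge M₁ m₁x≢z
  ... | yes _ | no m₂y≢w = unaddEdge M₂ m₂y≢w
  ... | yes m₁x≡z | yes m₂y≡w = Switching.matching xy yz y≁w M₁ M₂ m₁x≡z m₂y≡w

module PairedLists where

  open Parity
  open Matchings
  open import Data.Nat using (ℕ; suc; _+_)
  open import Data.Fin using (Fin; _≟_)
  open import Data.Bool using (false; _xor_)
  open import Data.Bool.Properties using (not-involutive)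
  open import Data.List using (List; []; _∷_; _++_; length; filter; allFin)
  open import Data.List.Properties using (length-tabulate; length-++)
  open import Data.List.Membership.Propositional using (_∈_)
  open import Data.List.Membership.Propositional.Properties using (∈-allFin)
  open import Data.List.Membership.Propositional.Properties.WithK using (unique∧set⇒bag)
  open import Data.List.Relation.Unary.Any using (here; there)
  import Data.List.Relation.Unary.All as All
  open import Data.List.Relation.Unary.Unique.Propositional using (Unique; []; _∷_)
  open import Data.List.Relation.Unary.Unique.Propositional.Properties using (allFin⁺; filter⁺)
  open import Data.List.Relation.Binary.BagAndSetEquality using (∼bag⇒↭)
  open import Data.List.Relation.Binary.Permutation.Propositional.Properties using (↭-length)
  open import Relation.Nullary using (yes; no; contradiction)
  open import Relation.Binary.PropositionalEquality
  open import Relation.Unary using (Pred; Decidable)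
  open import Level using (0ℓ)
  open import Function.Bundles using (mk⇔)
  open import Function using (_∘_)

  filter-allFin-unique : ∀ {n} {P : Pred (Fin n) 0ℓ} (P? : Decidable P) → Unique (filter P? (allFin n))
  filter-allFin-unique {n} P? = filter⁺ P? (allFin⁺ n)

  unique-complete-length : ∀ {n} {l : List (Fin n)} → Unique l → (∀ v → v ∈ l) → length l ≡ n
  unique-complete-length {n} {l} unique complete =
    trans (↭-length (∼bag⇒↭ (unique∧set⇒bag unique (allFin⁺ n) (mk⇔ (λ _ → ∈-allFin _) (λ _ → complete _)))))
          (length-tabulate (λ v → v))

  module _ {n : ℕ} {H : SimpleGraph n} where

    data Paired : List (Fin n) → Set where
      [] : Paired []
      pair : ∀ {a b l} → Adj H a b → Paired l → Paired (a ∷ b ∷ l)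

    Paired-++ : ∀ {l l′} → Paired l → Paired l′ → Paired (l ++ l′)
    Paired-++ [] p′ = p′
    Paired-++ (pair ab p) p′ = pair ab (Paired-++ p p′)

    Paired-even : ∀ {l} → Paired l → isOdd (length l) ≡ false
    Paired-even [] = refl
    Paired-even (pair {l = l} _ p) = trans (not-involutive (isOdd (length l))) (Paired-even p)

    clique⇒Paired : ∀ {l} → Unique l → (∀ {a b} → a ∈ l → b ∈ l → a ≢ b → Adj H a b) →
      isOdd (length l) ≡ false → Paired l
    clique⇒Paired {[]} _ _ _ = []
    clique⇒Paired {_ ∷ []} _ _ ()
    clique⇒Paired {a ∷ b ∷ l} ((a≢b All.∷ _) ∷ _ ∷ unique) clique even =
      pair (clique (here refl) (there (here refl)) a≢b)
           (clique⇒Paired unique (λ a∈ b∈ → clique (there (there a∈)) (there (there b∈)))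
                          (isOdd-pred (length l) (isOdd-pred (suc (length l)) even)))

    Paired-++-even : ∀ {l l′} → Paired l → (isOdd (length l′) ≡ false → Paired l′) →
      isOdd (length (l ++ l′)) ≡ false → Paired (l ++ l′)
    Paired-++-even {l} {l′} p p′ even = Paired-++ p (p′ (begin
      isOdd (length l′)                                 ≡⟨ cong (_xor isOdd (length l′)) (Paired-even p) ⟨
      isOdd (length l) xor isOdd (length l′)            ≡⟨ isOdd-+ (length l) (length l′) ⟨
      isOdd (length l + length l′)                      ≡⟨ cong isOdd (length-++ l) ⟨
      isOdd (length (l ++ l′))                          ≡⟨ even ⟩
      false                                             ∎))
      where open ≡-Reasoning

    partner : List (Fin n) → Fin n → Fin n
    partner (a ∷ b ∷ l) v with v ≟ a | v ≟ b
    ... | yes _ | _ = b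
    ... | no _ | yes _ = a
    ... | no _ | no _ = partner l v
    partner _ v = v

    partner-first : ∀ {a b l} → partner (a ∷ b ∷ l) a ≡ b
    partner-first {a} with a ≟ a
    ... | yes _ = refl
    ... | no a≢a = contradiction refl a≢a

    partner-second : ∀ {a b l} → a ≢ b → partner (a ∷ b ∷ l) b ≡ a
    partner-second {a} {b} a≢b with b ≟ a | b ≟ b
    ... | yes b≡a | _ = contradiction (sym b≡a) a≢b
    ... | no _ | yes _ = refl
    ... | no _ | no b≢b = contradiction refl b≢b

    partner-rest : ∀ {a b l v} → v ≢ a → v ≢ b → partner (a ∷ b ∷ l) v ≡ partner l v
    partner-rest {a} {b} {v = v} v≢a v≢b with v ≟ a | v ≟ b
    ... | yes v≡a | _ = contradiction v≡a v≢a
    ... | no _ | yes v≡b = contradiction v≡b v≢b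
    ... | no _ | no _ = refl

    record Partnered (l : List (Fin n)) (v : Fin n) : Set where
      field
        partner-∈ : partner l v ∈ l
        partner-involutive : partner l (partner l v) ≡ v
        partner-≢ : partner l v ≢ v
        partner-adj : Adj H v (partner l v)

    partnered : ∀ {l} → Unique l → Paired l → ∀ {v} → v ∈ l → Partnered l v
    partnered {a ∷ b ∷ l} ((a≢b All.∷ _) ∷ _) (pair ab _) (here refl) = record
      { partner-∈ = subst (_∈ a ∷ b ∷ l) (sym first) (there (here refl))
      ; partner-involutive = trans (cong (partner (a ∷ b ∷ l)) first) (partner-second a≢b)
      ; partner-≢ = λ b≡a → a≢b (sym (trans (sym first) b≡a))
      ; partner-adj = subst (Adj H a) (sym first) ab
      }
      where
      first : partner (a ∷ b ∷ l) a ≡ b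
      first = partner-first {a} {b} {l}
    partnered {a ∷ b ∷ l} ((a≢b All.∷ _) ∷ _) (pair ab _) (there (here refl)) = record
      { partner-∈ = subst (_∈ a ∷ b ∷ l) (sym second) (here refl)
      ; partner-involutive = trans (cong (partner (a ∷ b ∷ l)) second) (partner-first {a} {b} {l})
      ; partner-≢ = λ a≡b → a≢b (trans (sym second) a≡b)
      ; partner-adj = subst (Adj H b) (sym second) (trans (SimpleGraph.sym H b a) ab)
      }
      where
      second : partner (a ∷ b ∷ l) b ≡ a
      second = partner-second a≢b
    partnered {a ∷ b ∷ l} ((_ All.∷ a∉l) ∷ b∉l ∷ unique) (pair _ paired) {v} (there (there v∈l)) = record
      { partner-∈ = subst (_∈ _) (sym (rest v∈l)) (there (there partner-∈))
      ; partner-involutive = trans (cong (partner _) (rest v∈l)) (trans (rest partner-∈) partner-involutive)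
      ; partner-≢ = partner-≢ ∘ trans (sym (rest v∈l))
      ; partner-adj = subst (Adj H v) (sym (rest v∈l)) partner-adj
      }
      where
      open Partnered (partnered unique paired v∈l)
      rest : ∀ {u} → u ∈ l → partner (a ∷ b ∷ l) u ≡ partner l u
      rest u∈l = partner-rest (λ u≡a → All.lookup a∉l u∈l (sym u≡a)) (λ u≡b → All.lookup b∉l u∈l (sym u≡b))

    Paired⇒PerfectMatching : ∀ {l} → Unique l → Paired l → (∀ v → v ∈ l) → PerfectMatching H
    Paired⇒PerfectMatching {l} unique paired complete = record
      { mate = partner l
      ; mate-mate = λ v → Partnered.partner-involutive (spec v)
      ; mate-≢ = λ v → Partnered.partner-≢ (spec v)
      ; mate-adj = λ v → Partnered.partner-adj (spec v)
      }
      where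
      spec : ∀ v → Partnered l v
      spec v = partnered unique paired (complete v)

module SaturatedSupergraphs where

  open Sums
  open Parity
  open Counting
  open GraphBasics
  open Supergraphs
  open Matchings
  open PairedLists
  open import Data.Nat using (ℕ; _+_; _*_; _≤_; _<_; z≤n; s≤s; _≤?_)
  open import Data.Nat.Properties hiding (_≟_)
  open import Data.Fin using (Fin; _≟_; toℕ)
  open import Data.Fin.Properties using (all?; toℕ-injective; ¬∀⟶∃¬-smallest)
  open import Data.Bool using (Bool; true; false; not; _∧_; _∨_; _xor_)
  import Data.Bool.Properties as Bool
  open import Data.Product using (∃; _×_; _,_; proj₁; proj₂)
  open import Data.Sum using (_⊎_; inj₁; inj₂; [_,_]′; map; map₁; map₂)
  open import Relation.Nullary using (¬_; yes; no; contradiction; _→-dec_; _×-dec_)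
  open import Relation.Nullary.Decidable using (⌊_⌋; toSum; T?; toWitness)
  open import Relation.Unary using (Pred; Decidable)
  open import Relation.Binary.PropositionalEquality
  open import Function using (_∘_)
  open import Function.Bundles using (Equivalence)
  open import Data.List using (List; []; _∷_; _++_; length; filter; filterᵇ; allFin)
  open import Data.List.Membership.Propositional using (_∈_; _∉_)
  open import Data.List.Membership.Propositional.Properties using (∈-filter⁺; ∈-filter⁻; ∈-allFin; ∈-++⁺ˡ; ∈-++⁺ʳ; ∈-++⁻)
  open import Data.List.Relation.Unary.Any using (here; there)
  open import Data.List.Relation.Unary.All as All using (All; []; _∷_)
  open import Data.List.Relation.Unary.All.Properties using (¬Any⇒All¬; all-filter)
  open import Data.List.Relation.Unary.Unique.Propositional using (Unique; []; _∷_)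
  import Data.List.Relation.Unary.Unique.Propositional.Properties as Unique
  open import Level using (0ℓ)

  module Saturated {n : ℕ} {G : SimpleGraph n} (cubic : Cubic G) (bridgeless : Bridgeless G)
    {H : SimpleGraph n} (G⊆H : G ⊆ H)
    (saturated : ∀ {a b c} → ¬ Universal H b → Adj H a b → Adj H b c → a ≢ c → Adj H a c) where

    -- opaque, so that abstracting isUniversal v in a with does not also rewrite inside sameClass
    opaque
      isUniversal : Fin n → Bool
      isUniversal v = ⌊ universal? H v ⌋

      isUniversal⁺ : ∀ {v} → isUniversal v ≡ true → Universal H v
      isUniversal⁺ {v} _ with universal? H v
      ... | yes Uv = Uv

      isUniversal⁻ : ∀ {v} → isUniversal v ≡ false → ¬ Universal H v
      isUniversal⁻ {v} _ with universal? H v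
      ... | no ¬Uv = ¬Uv

      -- an equivalence relation on the non-universal vertices, transitive by saturation
      sameClass : Fin n → Fin n → Bool
      sameClass r u = not (isUniversal r) ∧ not (isUniversal u) ∧ (⌊ r ≟ u ⌋ ∨ adj H r u)

      sameClass⁻ : ∀ {r u} → sameClass r u ≡ true → isUniversal r ≡ false × isUniversal u ≡ false × (r ≡ u ⊎ Adj H r u)
      sameClass⁻ {r} {u} e with isUniversal r | isUniversal u | r ≟ u | adj H r u
      ... | false | false | yes r≡u | _ = refl , refl , inj₁ r≡u
      ... | false | false | no _ | true = refl , refl , inj₂ refl
      ... | false | false | no _ | false = contradiction e λ ()
      ... | false | true | _ | _ = contradiction e λ ()
      ... | true | _ | _ | _ = contradiction e λ ()

      sameClass⁺ : ∀ {r u} → isUniversal r ≡ false → isUniversal u ≡ false → r ≡ u ⊎ Adj H r u → sameClass r u ≡ true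
      sameClass⁺ {r} {u} r∉U u∉U r~u rewrite r∉U | u∉U with r ≟ u | r~u
      ... | yes _ | _ = refl
      ... | no r≢u | inj₁ r≡u = contradiction r≡u r≢u
      ... | no _ | inj₂ ru = ru

    nonUniversalʳ : ∀ {r u} → sameClass r u ≡ true → isUniversal u ≡ false
    nonUniversalʳ = proj₁ ∘ proj₂ ∘ sameClass⁻

    sameClass-refl : ∀ {r} → isUniversal r ≡ false → sameClass r r ≡ true
    sameClass-refl r∉U = sameClass⁺ r∉U r∉U (inj₁ refl)

    sameClass-sym : ∀ {r u} → sameClass r u ≡ true → sameClass u r ≡ true
    sameClass-sym e with r∉U , u∉U , r~u ← sameClass⁻ e =
      sameClass⁺ u∉U r∉U ([ inj₁ ∘ sym , inj₂ ∘ trans (SimpleGraph.sym H _ _) ]′ r~u)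

    sameClass-trans : ∀ {a b c} → sameClass a b ≡ true → sameClass b c ≡ true → sameClass a c ≡ true
    sameClass-trans {a} {b} {c} ab bc with sameClass⁻ ab | sameClass⁻ bc
    ... | _ , _ , inj₁ refl | _ = bc
    ... | _ , _ , inj₂ _ | _ , _ , inj₁ refl = ab
    ... | a∉U , b∉U , inj₂ a~b | _ , c∉U , inj₂ b~c =
      sameClass⁺ a∉U c∉U (map₂ (saturated (isUniversal⁻ b∉U) a~b b~c) (toSum (a ≟ c)))

    sameClass-universal : ∀ {r s} → isUniversal s ≡ true → sameClass r s ≡ false
    sameClass-universal {r} {s} s∈U with sameClass r s in e
    ... | false = refl
    ... | true = contradiction (trans (sym s∈U) (nonUniversalʳ e)) λ ()

    sameClass-G : ∀ {u v} → isUniversal u ≡ false → isUniversal v ≡ false → Adj G u v → sameClass u v ≡ true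
    sameClass-G u∉U v∉U uv = sameClass⁺ u∉U v∉U (inj₂ (G⊆H _ _ uv))

    IsRep : Pred (Fin n) 0ℓ
    IsRep r = isUniversal r ≡ false × (∀ u → sameClass r u ≡ true → toℕ r ≤ toℕ u)

    isRep? : Decidable IsRep
    isRep? r = (isUniversal r Bool.≟ false) ×-dec all? λ u → (sameClass r u Bool.≟ true) →-dec (toℕ r ≤? toℕ u)

    rep-unique : ∀ {r₁ r₂ u} → IsRep r₁ → IsRep r₂ → sameClass r₁ u ≡ true → sameClass r₂ u ≡ true → r₁ ≡ r₂
    rep-unique (_ , min₁) (_ , min₂) r₁u r₂u = toℕ-injective (≤-antisym
      (min₁ _ (sameClass-trans r₁u (sameClass-sym r₂u))) (min₂ _ (sameClass-trans r₂u (sameClass-sym r₁u))))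

    rep-exists : ∀ {v} → isUniversal v ≡ false → ∃ λ r → IsRep r × sameClass r v ≡ true
    rep-exists {v} v∉U
      with r , ¬vr , smaller ← ¬∀⟶∃¬-smallest n (λ u → sameClass v u ≡ false) (λ u → sameClass v u Bool.≟ false)
                                 (λ none → contradiction (trans (sym (none v)) (sameClass-refl v∉U)) λ ())
      = r , (nonUniversalʳ vr , minimal) , sameClass-sym vr
      where
      open import Data.Fin using (inject; fromℕ<)
      import Data.Fin.Properties as Fin
      vr : sameClass v r ≡ true
      vr = Bool.¬-not ¬vr
      minimal : ∀ u → sameClass r u ≡ true → toℕ r ≤ toℕ u
      minimal u ru with toℕ r ≤? toℕ u
      ... | yes r≤u = r≤u
      ... | no r≰u = contradiction (sameClass-trans vr ru) λ vu →
        contradiction (trans (sym (smaller (fromℕ< (≰⇒> r≰u)))) (trans (cong (sameClass v) u≡) vu)) λ ()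
        where
        u≡ : inject (fromℕ< (≰⇒> r≰u)) ≡ u
        u≡ = toℕ-injective (trans (Fin.toℕ-inject _) (Fin.toℕ-fromℕ< _))

    universalDegree : Fin n → ℕ
    universalDegree u = ∑[ s < n ] 𝟙 (isUniversal s ∧ adj G u s)

    classSize : Fin n → ℕ
    classSize r = ∑[ u < n ] 𝟙 (sameClass r u)

    boundary : Fin n → ℕ
    boundary r = ∑[ u < n ] (𝟙 (sameClass r u) * universalDegree u)

    module OddClass {r : Fin n} (r-odd : isOdd (classSize r) ≡ true) where

      innerDegree : Fin n → ℕ
      innerDegree u = ∑[ v < n ] 𝟙 (sameClass r v ∧ adj G u v)

      -- a G-neighbour of a class member is either universal or in the same class
      degree-split : ∀ {u} → sameClass r u ≡ true → 3 ≡ innerDegree u + universalDegree u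
      degree-split {u} ru = begin
        3
          ≡⟨ cubic-degree G cubic u ⟨
        ∑[ v < n ] 𝟙 (adj G u v)
          ≡⟨ sum-cong-≗ split ⟩
        ∑[ v < n ] (𝟙 (sameClass r v ∧ adj G u v) + 𝟙 (isUniversal v ∧ adj G u v))
          ≡⟨ ∑-distrib-+ _ (λ v → 𝟙 (isUniversal v ∧ adj G u v)) ⟩
        innerDegree u + universalDegree u ∎
        where
        open ≡-Reasoning
        split : ∀ v → 𝟙 (adj G u v) ≡ 𝟙 (sameClass r v ∧ adj G u v) + 𝟙 (isUniversal v ∧ adj G u v)
        split v with adj G u v in uv
        ... | false = sym (cong₂ _+_ (cong 𝟙 (Bool.∧-zeroʳ (sameClass r v))) (cong 𝟙 (Bool.∧-zeroʳ (isUniversal v))))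
        ... | true = byUniversality (isUniversal v) refl
          where
          byUniversality : ∀ b → isUniversal v ≡ b → 1 ≡ 𝟙 (sameClass r v ∧ true) + 𝟙 (isUniversal v ∧ true)
          byUniversality true v∈U rewrite sameClass-universal {r} v∈U | v∈U = refl
          byUniversality false v∉U rewrite sameClass-trans ru (sameClass-G (nonUniversalʳ ru) v∉U uv) | v∉U = refl

      weighted-split : ∀ u →
        𝟙 (sameClass r u) * 3 ≡ 𝟙 (sameClass r u) * innerDegree u + 𝟙 (sameClass r u) * universalDegree u
      weighted-split u with sameClass r u in ru
      ... | false = refl
      ... | true = trans (*-identityˡ 3) (trans (degree-split ru)
                     (sym (cong₂ _+_ (*-identityˡ (innerDegree u)) (*-identityˡ (universalDegree u)))))

      inner-double : ∃ λ k → ∑[ u < n ] (𝟙 (sameClass r u) * innerDegree u) ≡ k + k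
      inner-double =
        let k , ∑∑≡k+k = sum-symmetric-double (λ u v → 𝟙 (sameClass r u ∧ sameClass r v ∧ adj G u v)) symmetric diagonal
        in k , trans (sum-cong-≗ λ u → trans (*-distribˡ-sum (𝟙 (sameClass r u)) (λ v → 𝟙 (sameClass r v ∧ adj G u v)))
                                             (sum-cong-≗ λ v → sym (𝟙-∧ (sameClass r u) (sameClass r v ∧ adj G u v))))
                     ∑∑≡k+k
        where
        symmetric : ∀ u v →
          𝟙 (sameClass r u ∧ sameClass r v ∧ adj G u v) ≡ 𝟙 (sameClass r v ∧ sameClass r u ∧ adj G v u)
        symmetric u v rewrite SimpleGraph.sym G u v with sameClass r u | sameClass r v
        ... | true | true = refl
        ... | true | false = refl
        ... | false | true = refl
        ... | false | false = refl
        diagonal : ∀ u → 𝟙 (sameClass r u ∧ sameClass r u ∧ adj G u u) ≡ 0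
        diagonal u rewrite loopless G u | Bool.∧-zeroʳ (sameClass r u) | Bool.∧-zeroʳ (sameClass r u) = refl

      -- 3 |C| = 2 (edges inside C) + (edges from C to the universal vertices)
      boundary-odd : isOdd (boundary r) ≡ true
      boundary-odd with k , inner≡k+k ← inner-double = begin
        isOdd (boundary r)                                ≡⟨ cong (_xor isOdd (boundary r)) (isOdd-double k) ⟨
        isOdd (k + k) xor isOdd (boundary r)              ≡⟨ isOdd-+ (k + k) (boundary r) ⟨
        isOdd (k + k + boundary r)                        ≡⟨ cong isOdd three-times ⟨
        isOdd (classSize r * 3)                           ≡⟨ isOdd-* (classSize r) 3 ⟩
        isOdd (classSize r) ∧ true                        ≡⟨ Bool.∧-identityʳ _ ⟩
        isOdd (classSize r)                               ≡⟨ r-odd ⟩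
        true                                              ∎
        where
        open ≡-Reasoning
        three-times : classSize r * 3 ≡ k + k + boundary r
        three-times = begin
          classSize r * 3                                    ≡⟨ *-distribʳ-sum 3 (λ u → 𝟙 (sameClass r u)) ⟩
          ∑[ u < n ] (𝟙 (sameClass r u) * 3)                 ≡⟨ sum-cong-≗ weighted-split ⟩
          ∑[ u < n ] (𝟙 (sameClass r u) * innerDegree u + 𝟙 (sameClass r u) * universalDegree u)
            ≡⟨ ∑-distrib-+ (λ u → 𝟙 (sameClass r u) * innerDegree u) (λ u → 𝟙 (sameClass r u) * universalDegree u) ⟩
          ∑[ u < n ] (𝟙 (sameClass r u) * innerDegree u) + boundary r ≡⟨ cong (_+ boundary r) inner≡k+k ⟩
          k + k + boundary r                                 ∎

      contribution : Fin n → ℕ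
      contribution u = 𝟙 (sameClass r u) * universalDegree u

      universalNeighbour : ∀ {u s} → isUniversal s ≡ true → Adj G u s → 1 ≤ universalDegree u
      universalNeighbour {u} {s} s∈U us = subst (_≤ universalDegree u) (cong 𝟙 (cong₂ _∧_ s∈U us)) (term≤sum _ s)

      member≤contribution : ∀ {u s} → sameClass r u ≡ true → isUniversal s ≡ true → Adj G u s → 1 ≤ contribution u
      member≤contribution {u} ru s∈U us = subst (1 ≤_) (sym (𝟙*-true (universalDegree u) ru)) (universalNeighbour s∈U us)

      -- the edge a b by which a walk in G - us leaves the class is a second edge towards the universal vertices
      twoExits : ∀ {u s a b} → sameClass r u ≡ true → isUniversal s ≡ true → Adj G u s →
        sameClass r a ≡ true → isUniversal b ≡ true → deleteEdge G u s a b ≡ true → 2 ≤ boundary r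
      twoExits {u} {s} {a} {b} ru s∈U us ra b∈U ab with u ≟ a
      ... | no u≢a = ≤-trans (+-mono-≤ (member≤contribution ru s∈U us) (member≤contribution ra b∈U (deleteEdge⇒adj G ab)))
                             (twoTerms≤sum contribution u≢a)
      ... | yes refl = begin
        2
          ≡⟨ cong₂ (λ p q → 𝟙 p + 𝟙 q) (cong₂ _∧_ s∈U us) (cong₂ _∧_ b∈U (deleteEdge⇒adj G ab)) ⟨
        𝟙 (isUniversal s ∧ adj G u s) + 𝟙 (isUniversal b ∧ adj G u b)
          ≤⟨ twoTerms≤sum (λ t → 𝟙 (isUniversal t ∧ adj G u t)) s≢b ⟩
        universalDegree u
          ≡⟨ 𝟙*-true (universalDegree u) ru ⟨
        contribution u
          ≤⟨ term≤sum contribution u ⟩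
        boundary r ∎
        where
        open ≤-Reasoning
        s≢b : s ≢ b
        s≢b refl = contradiction (trans (sym ab) (deleteEdge-deleted G u s)) λ ()

      boundary≥2 : 2 ≤ boundary r
      boundary≥2 =
        let u , 0<cu = sum-pos⇒term-pos contribution (isOdd⇒pos _ boundary-odd)
            ru , 0<du = 𝟙*-pos (sameClass r u) (universalDegree u) 0<cu
            s , 0<us = sum-pos⇒term-pos (λ s → 𝟙 (isUniversal s ∧ adj G u s)) 0<du
            s∈U , us = ∧-true (𝟙-pos 0<us)
            a , b , ra , ¬rb , ab = walk-crossing (sameClass r) (bridgeless u s us) ru (sameClass-universal s∈U)
        in twoExits ru s∈U us ra (exit-universal ra ¬rb (deleteEdge⇒adj G ab)) ab
        where
        ∧-true : ∀ {x y} → x ∧ y ≡ true → x ≡ true × y ≡ true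
        ∧-true {true} {true} _ = refl , refl
        exit-universal : ∀ {a b} → sameClass r a ≡ true → sameClass r b ≡ false → Adj G a b → isUniversal b ≡ true
        exit-universal {b = b} ra ¬rb ab with isUniversal b in b∈U
        ... | true = refl
        ... | false = contradiction (trans (sym ¬rb) (sameClass-trans ra (sameClass-G (nonUniversalʳ ra) b∈U ab))) λ ()

      boundary≥3 : 3 ≤ boundary r
      boundary≥3 = ≤∧≢⇒< boundary≥2 λ 2≡B → contradiction (trans (cong isOdd 2≡B) boundary-odd) λ ()

    IsOddRep : Pred (Fin n) 0ℓ
    IsOddRep r = IsRep r × isOdd (classSize r) ≡ true

    isOddRep? : Decidable IsOddRep
    isOddRep? r = isRep? r ×-dec (isOdd (classSize r) Bool.≟ true)

    oddRep : Fin n → Bool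
    oddRep r = ⌊ isOddRep? r ⌋

    oddRep⇒IsRep : ∀ {r} → oddRep r ≡ true → IsRep r
    oddRep⇒IsRep r-odd = proj₁ (toWitness (Equivalence.from Bool.T-≡ r-odd))

    universalDegree-total : ∑[ u < n ] universalDegree u ≡ ∑[ s < n ] 𝟙 (isUniversal s) * 3
    universalDegree-total = begin
      ∑[ u < n ] ∑[ s < n ] 𝟙 (isUniversal s ∧ adj G u s)
        ≡⟨ ∑-comm (λ u s → 𝟙 (isUniversal s ∧ adj G u s)) ⟩
      ∑[ s < n ] ∑[ u < n ] 𝟙 (isUniversal s ∧ adj G u s)
        ≡⟨ sum-cong-≗ (λ s → sum-cong-≗ λ u →
             trans (𝟙-∧ (isUniversal s) _) (cong (λ b → 𝟙 (isUniversal s) * 𝟙 b) (SimpleGraph.sym G u s))) ⟩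
      ∑[ s < n ] ∑[ u < n ] (𝟙 (isUniversal s) * 𝟙 (adj G s u))
        ≡⟨ sum-cong-≗ (λ s → sym (*-distribˡ-sum (𝟙 (isUniversal s)) (λ u → 𝟙 (adj G s u)))) ⟩
      ∑[ s < n ] (𝟙 (isUniversal s) * ∑[ u < n ] 𝟙 (adj G s u))
        ≡⟨ sum-cong-≗ (λ s → cong (𝟙 (isUniversal s) *_) (cubic-degree G cubic s)) ⟩
      ∑[ s < n ] (𝟙 (isUniversal s) * 3)
        ≡⟨ *-distribʳ-sum 3 (λ s → 𝟙 (isUniversal s)) ⟨
      ∑[ s < n ] 𝟙 (isUniversal s) * 3 ∎
      where open ≡-Reasoning

    -- odd classes are disjoint, so every vertex is counted in at most one of their boundaries
    oddBoundaries≤ : ∑[ r < n ] (𝟙 (oddRep r) * boundary r) ≤ ∑[ u < n ] universalDegree u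
    oddBoundaries≤ = begin
      ∑[ r < n ] (𝟙 (oddRep r) * boundary r)
        ≡⟨ sum-cong-≗ (λ r → *-distribˡ-sum (𝟙 (oddRep r)) (λ u → 𝟙 (sameClass r u) * universalDegree u)) ⟩
      ∑[ r < n ] ∑[ u < n ] (𝟙 (oddRep r) * (𝟙 (sameClass r u) * universalDegree u))
        ≡⟨ ∑-comm (λ r u → 𝟙 (oddRep r) * (𝟙 (sameClass r u) * universalDegree u)) ⟩
      ∑[ u < n ] ∑[ r < n ] (𝟙 (oddRep r) * (𝟙 (sameClass r u) * universalDegree u))
        ≡⟨ sum-cong-≗ (λ u → trans (sum-cong-≗ λ r → sym (*-assoc (𝟙 (oddRep r)) _ _))
                                   (sym (*-distribʳ-sum (universalDegree u) (λ r → 𝟙 (oddRep r) * 𝟙 (sameClass r u))))) ⟩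
      ∑[ u < n ] (∑[ r < n ] (𝟙 (oddRep r) * 𝟙 (sameClass r u)) * universalDegree u)
        ≤⟨ sum-mono-≤ (λ u → ≤-trans (*-monoˡ-≤ (universalDegree u) (atMostOne u)) (≤-reflexive (*-identityˡ _))) ⟩
      ∑[ u < n ] universalDegree u ∎
      where
      open ≤-Reasoning
      atMostOne : ∀ u → ∑[ r < n ] (𝟙 (oddRep r) * 𝟙 (sameClass r u)) ≤ 1
      atMostOne u = sum≤1 _ (λ r → subst (_≤ 1) (𝟙-∧ (oddRep r) (sameClass r u)) (𝟙≤1 _)) λ i j 0<i 0<j →
        let i-odd , iu = 𝟙*-pos (oddRep i) _ 0<i
            j-odd , ju = 𝟙*-pos (oddRep j) _ 0<j
        in rep-unique (oddRep⇒IsRep i-odd) (oddRep⇒IsRep j-odd) (𝟙-pos iu) (𝟙-pos ju)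

    oddClasses≤universals : ∑[ r < n ] 𝟙 (oddRep r) ≤ ∑[ s < n ] 𝟙 (isUniversal s)
    oddClasses≤universals = *-cancelʳ-≤ _ _ 3 (begin
      ∑[ r < n ] 𝟙 (oddRep r) * 3              ≡⟨ *-distribʳ-sum 3 (λ r → 𝟙 (oddRep r)) ⟩
      ∑[ r < n ] (𝟙 (oddRep r) * 3)            ≤⟨ sum-mono-≤ atLeastThree ⟩
      ∑[ r < n ] (𝟙 (oddRep r) * boundary r)   ≤⟨ oddBoundaries≤ ⟩
      ∑[ u < n ] universalDegree u             ≡⟨ universalDegree-total ⟩
      ∑[ s < n ] 𝟙 (isUniversal s) * 3         ∎)
      where
      open ≤-Reasoning
      atLeastThree : ∀ r → 𝟙 (oddRep r) * 3 ≤ 𝟙 (oddRep r) * boundary r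
      atLeastThree r with isOddRep? r
      ... | yes (_ , r-odd) = +-monoˡ-≤ 0 (OddClass.boundary≥3 r-odd)
      ... | no _ = z≤n

    members : Fin n → List (Fin n)
    members r = filterᵇ (sameClass r) (allFin n)

    ∈-members⁺ : ∀ {r v} → sameClass r v ≡ true → v ∈ members r
    ∈-members⁺ {r} {v} rv = ∈-filter⁺ (T? ∘ sameClass r) (∈-allFin v) (Equivalence.from Bool.T-≡ rv)

    ∈-members⁻ : ∀ {r v} → v ∈ members r → sameClass r v ≡ true
    ∈-members⁻ {r} m = Equivalence.to Bool.T-≡ (proj₂ (∈-filter⁻ (T? ∘ sameClass r) {xs = allFin n} m))

    members-unique : ∀ r → Unique (members r)
    members-unique r = filter-allFin-unique (T? ∘ sameClass r)

    members-clique : ∀ {r a b} → a ∈ members r → b ∈ members r → a ≢ b → Adj H a b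
    members-clique a∈ b∈ a≢b with sameClass⁻ (sameClass-trans (sameClass-sym (∈-members⁻ a∈)) (∈-members⁻ b∈))
    ... | _ , _ , inj₁ a≡b = contradiction a≡b a≢b
    ... | _ , _ , inj₂ ab = ab

    AllUniversal : List (Fin n) → Set
    AllUniversal = All (λ s → isUniversal s ≡ true)

    universal∉members : ∀ {r s} → isUniversal s ≡ true → s ∉ members r
    universal∉members s∈U s∈ = contradiction (trans (sym s∈U) (nonUniversalʳ (∈-members⁻ s∈))) λ ()

    pairUp : List (Fin n) → List (Fin n) → List (Fin n)
    pairUp [] ss = ss
    pairUp (r ∷ rs) [] = members r ++ pairUp rs []
    pairUp (r ∷ rs) (s ∷ ss) = s ∷ members r ++ pairUp rs ss

    InClassOf : List (Fin n) → Pred (Fin n) 0ℓ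
    InClassOf rs v = ∃ λ r → r ∈ rs × sameClass r v ≡ true

    ∈-pairUp⁻ : ∀ rs ss {v} → v ∈ pairUp rs ss → InClassOf rs v ⊎ v ∈ ss
    ∈-pairUp⁻ [] ss v∈ = inj₂ v∈
    ∈-pairUp⁻ (r ∷ rs) [] v∈ = fromBlock rs [] (∈-++⁻ (members r) v∈)
      where
      fromBlock : ∀ rs ss {v} → v ∈ members r ⊎ v ∈ pairUp rs ss → InClassOf (r ∷ rs) v ⊎ v ∈ ss
      fromBlock rs ss (inj₁ v∈r) = inj₁ (r , here refl , ∈-members⁻ v∈r)
      fromBlock rs ss (inj₂ v∈) = map₁ (λ (r′ , r′∈ , r′v) → r′ , there r′∈ , r′v) (∈-pairUp⁻ rs ss v∈)
    ∈-pairUp⁻ (r ∷ rs) (s ∷ ss) (here refl) = inj₂ (here refl)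
    ∈-pairUp⁻ (r ∷ rs) (s ∷ ss) (there v∈) with ∈-++⁻ (members r) v∈
    ... | inj₁ v∈r = inj₁ (r , here refl , ∈-members⁻ v∈r)
    ... | inj₂ v∈′ = map (λ (r′ , r′∈ , r′v) → r′ , there r′∈ , r′v) there (∈-pairUp⁻ rs ss v∈′)

    ∈-pairUp⁺ : ∀ rs ss {v} → InClassOf rs v ⊎ v ∈ ss → v ∈ pairUp rs ss
    ∈-pairUp⁺ [] ss (inj₂ v∈) = v∈
    ∈-pairUp⁺ (r ∷ rs) [] (inj₁ (_ , here refl , rv)) = ∈-++⁺ˡ (∈-members⁺ rv)
    ∈-pairUp⁺ (r ∷ rs) [] (inj₁ (r′ , there r′∈ , r′v)) = ∈-++⁺ʳ (members r) (∈-pairUp⁺ rs [] (inj₁ (r′ , r′∈ , r′v)))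
    ∈-pairUp⁺ (r ∷ rs) (s ∷ ss) (inj₁ (_ , here refl , rv)) = there (∈-++⁺ˡ (∈-members⁺ rv))
    ∈-pairUp⁺ (r ∷ rs) (s ∷ ss) (inj₁ (r′ , there r′∈ , r′v)) =
      there (∈-++⁺ʳ (members r) (∈-pairUp⁺ rs ss (inj₁ (r′ , r′∈ , r′v))))
    ∈-pairUp⁺ (r ∷ rs) (s ∷ ss) (inj₂ (here refl)) = here refl
    ∈-pairUp⁺ (r ∷ rs) (s ∷ ss) (inj₂ (there v∈)) = there (∈-++⁺ʳ (members r) (∈-pairUp⁺ rs ss (inj₂ v∈)))

    class-separated : ∀ {r rs v} → IsRep r → All (r ≢_) rs → All IsRep rs → v ∈ members r → ¬ InClassOf rs v
    class-separated r-rep r∉rs reps v∈r (r′ , r′∈rs , r′v) =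
      All.lookup r∉rs r′∈rs (rep-unique r-rep (All.lookup reps r′∈rs) (∈-members⁻ v∈r) r′v)

    pairUp-unique : ∀ rs ss → Unique rs → All IsRep rs → Unique ss → AllUniversal ss →
      Unique (pairUp rs ss)
    pairUp-unique [] ss _ _ ss-unique _ = ss-unique
    pairUp-unique (r ∷ rs) ss (r∉rs ∷ rs-unique) (r-rep ∷ reps) = byHead ss
      where
      block-unique : ∀ ss → Unique ss → AllUniversal ss → Unique (members r ++ pairUp rs ss)
      block-unique ss ss-unique universals =
        Unique.++⁺ (members-unique r) (pairUp-unique rs ss rs-unique reps ss-unique universals) λ (v∈r , v∈rest) →
          [ class-separated r-rep r∉rs reps v∈r , (λ v∈ss → universal∉members (All.lookup universals v∈ss) v∈r) ]′
            (∈-pairUp⁻ rs ss v∈rest)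
      byHead : ∀ ss → Unique ss → AllUniversal ss → Unique (pairUp (r ∷ rs) ss)
      byHead [] = block-unique []
      byHead (s ∷ ss) (s∉ss ∷ ss-unique) (s∈U ∷ universals) =
        ¬Any⇒All¬ _ s∉block ∷ block-unique ss ss-unique universals
        where
        s∉block : s ∉ members r ++ pairUp rs ss
        s∉block s∈ with ∈-++⁻ (members r) s∈
        ... | inj₁ s∈r = universal∉members s∈U s∈r
        ... | inj₂ s∈rest with ∈-pairUp⁻ rs ss s∈rest
        ...   | inj₁ (_ , _ , r′s) = contradiction (trans (sym s∈U) (nonUniversalʳ r′s)) λ ()
        ...   | inj₂ s∈ss = All.lookup s∉ss s∈ss refl

    members-even-Paired : ∀ {r} → isOdd (classSize r) ≡ false → Paired {H = H} (members r)
    members-even-Paired {r} even =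
      clique⇒Paired (members-unique r) members-clique (trans (cong isOdd (count-filterᵇ (sameClass r))) even)

    members-odd-Paired : ∀ {r s} → isOdd (classSize r) ≡ true → isUniversal s ≡ true → Paired {H = H} (s ∷ members r)
    members-odd-Paired {r} {s} odd s∈U =
      clique⇒Paired (¬Any⇒All¬ _ (universal∉members s∈U) ∷ members-unique r) clique
        (cong not (trans (cong isOdd (count-filterᵇ (sameClass r))) odd))
      where
      clique : ∀ {a b} → a ∈ s ∷ members r → b ∈ s ∷ members r → a ≢ b → Adj H a b
      clique (here refl) (here refl) a≢b = contradiction refl a≢b
      clique (here refl) (there _) a≢b = isUniversal⁺ s∈U _ (a≢b ∘ sym)
      clique (there _) (here refl) a≢b = trans (SimpleGraph.sym H _ _) (isUniversal⁺ s∈U _ a≢b)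
      clique (there a∈) (there b∈) a≢b = members-clique a∈ b∈ a≢b

    universals-Paired : ∀ {ss} → Unique ss → AllUniversal ss → isOdd (length ss) ≡ false → Paired {H = H} ss
    universals-Paired unique universals =
      clique⇒Paired unique λ a∈ b∈ a≢b → isUniversal⁺ (All.lookup universals a∈) _ (a≢b ∘ sym)

    evenClasses-Paired : ∀ rs → All (λ r → isOdd (classSize r) ≡ false) rs → Paired {H = H} (pairUp rs [])
    evenClasses-Paired [] [] = []
    evenClasses-Paired (r ∷ rs) (even ∷ evens) = Paired-++ (members-even-Paired even) (evenClasses-Paired rs evens)

    oddClasses-Paired : ∀ rs ss → All (λ r → isOdd (classSize r) ≡ true) rs → Unique ss → AllUniversal ss →
      length rs ≤ length ss → isOdd (length (pairUp rs ss)) ≡ false → Paired {H = H} (pairUp rs ss)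
    oddClasses-Paired [] ss [] unique universals _ even = universals-Paired unique universals even
    oddClasses-Paired (r ∷ rs) (s ∷ ss) (odd ∷ odds) (_ ∷ unique) (s∈U ∷ universals) (s≤s enough) =
      Paired-++-even (members-odd-Paired odd s∈U) (oddClasses-Paired rs ss odds unique universals enough)

    IsEvenRep : Pred (Fin n) 0ℓ
    IsEvenRep r = IsRep r × isOdd (classSize r) ≡ false

    isEvenRep? : Decidable IsEvenRep
    isEvenRep? r = isRep? r ×-dec (isOdd (classSize r) Bool.≟ false)

    evenReps oddReps universals arrangement : List (Fin n)
    evenReps = filter isEvenRep? (allFin n)
    oddReps = filter isOddRep? (allFin n)
    universals = filterᵇ isUniversal (allFin n)
    arrangement = pairUp evenReps [] ++ pairUp oddReps universals

    universals-universal : AllUniversal universals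
    universals-universal = All.map (Equivalence.to Bool.T-≡) (all-filter (T? ∘ isUniversal) (allFin n))

    arrangement-unique : Unique arrangement
    arrangement-unique = Unique.++⁺
      (pairUp-unique evenReps [] (filter-allFin-unique isEvenRep?) (All.map proj₁ (all-filter isEvenRep? (allFin n))) [] [])
      (pairUp-unique oddReps universals (filter-allFin-unique isOddRep?) (All.map proj₁ (all-filter isOddRep? (allFin n)))
        (filter-allFin-unique (T? ∘ isUniversal)) universals-universal)
      disjoint
      where
      disjoint : ∀ {v} → ¬ (v ∈ pairUp evenReps [] × v ∈ pairUp oddReps universals)
      disjoint (v∈E , v∈O) with ∈-pairUp⁻ evenReps [] v∈E | ∈-pairUp⁻ oddReps universals v∈O
      ... | inj₁ (r , r∈ , rv) | inj₁ (r′ , r′∈ , r′v) =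
        let r-rep , r-even = proj₂ (∈-filter⁻ isEvenRep? {xs = allFin n} r∈)
            r′-rep , r′-odd = proj₂ (∈-filter⁻ isOddRep? {xs = allFin n} r′∈)
        in contradiction (trans (sym r-even) (trans (cong (isOdd ∘ classSize) (rep-unique r-rep r′-rep rv r′v)) r′-odd)) λ ()
      ... | inj₁ (_ , _ , rv) | inj₂ v∈U =
        contradiction (trans (sym (All.lookup universals-universal v∈U)) (nonUniversalʳ rv)) λ ()

    arrangement-complete : ∀ v → v ∈ arrangement
    arrangement-complete v with isUniversal v in v∈U
    ... | true = ∈-++⁺ʳ (pairUp evenReps []) (∈-pairUp⁺ oddReps universals
                   (inj₂ (∈-filter⁺ (T? ∘ isUniversal) (∈-allFin v) (Equivalence.from Bool.T-≡ v∈U))))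
    ... | false with rep-exists v∈U
    ...   | r , r-rep , rv with isOdd (classSize r) in parity
    ...     | true = ∈-++⁺ʳ (pairUp evenReps []) (∈-pairUp⁺ oddReps universals
                       (inj₁ (r , ∈-filter⁺ isOddRep? (∈-allFin r) (r-rep , parity) , rv)))
    ...     | false = ∈-++⁺ˡ (∈-pairUp⁺ evenReps [] (inj₁ (r , ∈-filter⁺ isEvenRep? (∈-allFin r) (r-rep , parity) , rv)))

    arrangement-Paired : Paired {H = H} arrangement
    arrangement-Paired = Paired-++-even
      (evenClasses-Paired evenReps (All.map proj₂ (all-filter isEvenRep? (allFin n))))
      (oddClasses-Paired oddReps universals (All.map proj₂ (all-filter isOddRep? (allFin n)))
        (filter-allFin-unique (T? ∘ isUniversal)) universals-universal enough)
      (trans (cong isOdd (unique-complete-length arrangement-unique arrangement-complete)) (cubic⇒even G cubic))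
      where
      enough : length oddReps ≤ length universals
      enough = subst₂ _≤_ (sym (count-filter isOddRep?)) (sym (count-filterᵇ isUniversal)) oddClasses≤universals

    perfectMatching : PerfectMatching H
    perfectMatching = Paired⇒PerfectMatching arrangement-unique arrangement-Paired arrangement-complete

module PetersenTheorem where

  open Supergraphs
  open Matchings
  open LovaszSwitching
  open SaturatedSupergraphs
  open import Data.Nat using (ℕ; _<_)
  open import Data.Nat.Induction using (<-wellFounded)
  open import Induction.WellFounded using (Acc; acc)
  open import Data.Fin using (Fin; _≟_)
  open import Data.Fin.Properties using (any?)
  open import Data.Bool using (true; false)
  import Data.Bool.Properties as Bool
  open import Data.Product using (Σ; _×_; _,_)
  open import Relation.Nullary using (¬_; Dec; yes; no; contradiction; ¬?; _×-dec_)
  open import Relation.Binary.PropositionalEquality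

  module _ {n : ℕ} {H : SimpleGraph n} where

    Unsaturated : Fin n → Fin n → Fin n → Set
    Unsaturated x y z = ¬ Universal H y × Adj H x y × Adj H y z × x ≢ z × adj H x z ≡ false

    unsaturated? : ∀ x y z → Dec (Unsaturated x y z)
    unsaturated? x y z = ¬? (universal? H y) ×-dec (adj H x y Bool.≟ true) ×-dec (adj H y z Bool.≟ true)
                           ×-dec ¬? (x ≟ z) ×-dec (adj H x z Bool.≟ false)

  module _ {n : ℕ} {G : SimpleGraph n} (cubic : Cubic G) (bridgeless : Bridgeless G) where

    supergraphMatching : ∀ H → Acc _<_ (nonEdges H) → G ⊆ H → PerfectMatching H
    supergraphMatching H (acc smaller) G⊆H with any? (λ x → any? (λ y → any? (λ z → unsaturated? {H = H} x y z)))
    ... | no none = Saturated.perfectMatching {G = G} cubic bridgeless G⊆H saturated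
      where
      saturated : ∀ {a b c} → ¬ Universal H b → Adj H a b → Adj H b c → a ≢ c → Adj H a c
      saturated {a} {b} {c} ¬Ub ab bc a≢c with adj H a c in ac
      ... | true = refl
      ... | false = contradiction (a , b , c , ¬Ub , ab , bc , a≢c , ac) none
    ... | yes (x , y , z , ¬Uy , xy , yz , x≢z , x≁z) with w , y≢w , y≁w ← nonNeighbour {H = H} ¬Uy =
      switch x≢z y≢w xy yz y≁w (grow x≢z x≁z) (grow y≢w y≁w)
      where
      grow : ∀ {a b} (a≢b : a ≢ b) → adj H a b ≡ false → PerfectMatching (addEdge H a b a≢b)
      grow {a} {b} a≢b a≁b = supergraphMatching (addEdge H a b a≢b) (smaller (addEdge-nonEdges H a≢b a≁b))
        λ u v uv → ⊆-addEdge {H = H} {a≢b = a≢b} u v (G⊆H u v uv)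

    petersen : PerfectMatching G
    petersen = supergraphMatching G (<-wellFounded (nonEdges G)) λ _ _ uv → uv

open MatchingToColoring using (perfectMatching⇒coloring)
open PetersenTheorem using (petersen)

-- Petersen's theorem needs no connectivity
mainTheorem19 : (n : ℕ) (G : SimpleGraph n) → Connected G → Bridgeless G → Cubic G →
    Σ (Signature G) λ σ → HasProper3EdgeColoring G σ
mainTheorem19 n G _ bridgeless cubic = perfectMatching⇒coloring cubic (petersen {G = G} cubic bridgeless)
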